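{- If $T_\lambda$ and $T_\mu$ are spiders with $X_{T_\lambda}^{T_\lambda}=X_{T_\mu}^{T_\mu}$, then $\ell(\lambda)=\ell(\mu)$; that is, the self-chromatic symmetric function of a spider determines its number of legs.
   Context: A spider is a tree with exactly one vertex of degree at least 3 (the torso $t$); it is the union of edge-disjoint paths (legs) from $t$ to the leaves. An $n$-vertex spider is encoded by the partition $\lambda\vdash n-1$ whose parts are the lengths (numbers of edges) of its legs, and is denoted $T_\lambda$; $\ell(\lambda)\ge 3$ is the number of legs. A graph homomorphism $f:G\to H$ is a map $V(G)\to V(H)$ sending edges to edges; its type is the partition of nonzero preimage sizes $|f^{ -1}(w)|$. For a partition $\lambda$ with $r_i(\lambda)$ parts equal to $i$, $m_\lambda^N=\frac{N!}{\binom{N}{r_1(\lambda),r_2(\lambda),\dots,N-\ell(\lambda)}}m_\lambda$ with $m_\lambda$ the monomial symmetric function. The $H$-chromatic symmetric function is $X_G^H=\sum_\lambda d_\lambda m_\lambda^{|V(H)|}$, $d_\lambda$ the number of homomorphisms $G\to H$ of type $\lambda$; $X_G^G$ is the self-chromatic symmetric function. -}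

module Defs where

open import Data.Nat using (ℕ; zero; suc; _+_; _*_; _∸_; _≤_; _≥_; _≡ᵇ_; _≤ᵇ_)
open import Data.Nat.Combinatorics using (_C_)
open import Data.Bool using (Bool; true; false; _∧_; _∨_; not; if_then_else_)
open import Data.Fin using (Fin; toℕ)
open import Data.Fin.Properties using () renaming (_≟_ to _≟ᶠ_)
open import Data.List using (List; []; _∷_; length; map; filter; filterᵇ; concatMap; upTo; allFin; product; foldr)
open import Data.List.Relation.Unary.All using (All)
open import Data.List.Relation.Unary.Linked using (Linked)
open import Data.Vec using (Vec; []; _∷_; lookup)
open import Data.Nat.ListAction using (sum)
open import Data.Bool.ListAction using (all; any)

record Graph : Set where
  field
    nV  : ℕ
    adj : Fin nV → Fin nV → Bool
open Graph public

IsPartition : List ℕ → Set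
IsPartition λ′ = All (λ k → 1 ≤ k) λ′ × Linked _≥_ λ′
  where open import Data.Product using (_×_)

ℓ : List ℕ → ℕ
ℓ = length

-- Vertex 0 is the torso; leg i (of length λ_i) occupies
-- the consecutive vertices o_i+1, …, o_i+λ_i where o_i = λ_1+…+λ_{i-1}.
-- Edges: torso — o_i+1 for each leg, and u — u+1 whenever u ≥ 1 and
-- u+1 is not the first vertex of a leg.

legStarts : List ℕ → ℕ → List ℕ
legStarts []       o = []
legStarts (a ∷ as) o = suc o ∷ legStarts as (o + a)

isStart : List ℕ → ℕ → Bool
isStart λ′ v = any (λ s → s ≡ᵇ v) (legStarts λ′ 0)

step : List ℕ → ℕ → ℕ → Bool
step λ′ zero    v = isStart λ′ v
step λ′ (suc u) v = (v ≡ᵇ suc (suc u)) ∧ not (isStart λ′ v)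

spider : List ℕ → Graph
spider λ′ = record
  { nV  = suc (sum λ′)
  ; adj = λ u v → step λ′ (toℕ u) (toℕ v) ∨ step λ′ (toℕ v) (toℕ u)
  }

allMaps : (k m : ℕ) → List (Vec (Fin m) k)
allMaps zero    m = [] ∷ []
allMaps (suc k) m = concatMap (λ x → map (x ∷_) (allMaps k m)) (allFin m)

isHom : (G H : Graph) → Vec (Fin (nV H)) (nV G) → Bool
isHom G H f =
  all (λ u → all (λ v → not (adj G u v) ∨ adj H (lookup f u) (lookup f v))
                 (allFin (nV G)))
      (allFin (nV G))

insertDesc : ℕ → List ℕ → List ℕ
insertDesc x []       = x ∷ []
insertDesc x (y ∷ ys) = if y ≤ᵇ x then x ∷ y ∷ ys else y ∷ insertDesc x ys

sortDesc : List ℕ → List ℕ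
sortDesc = foldr insertDesc []

preimageSize : {k m : ℕ} → Vec (Fin m) k → Fin m → ℕ
preimageSize {k} f w = length (filter (λ u → lookup f u ≟ᶠ w) (allFin k))

homType : {k m : ℕ} → Vec (Fin m) k → List ℕ
homType {m = m} f =
  sortDesc (filterᵇ (λ s → not (s ≡ᵇ 0)) (map (preimageSize f) (allFin m)))

listEqᵇ : List ℕ → List ℕ → Bool
listEqᵇ []       []       = true
listEqᵇ (x ∷ xs) (y ∷ ys) = (x ≡ᵇ y) ∧ listEqᵇ xs ys
listEqᵇ _        _        = false

d : (G H : Graph) → List ℕ → ℕ
d G H λ′ =
  length (filterᵇ (λ f → isHom G H f ∧ listEqᵇ (homType f) λ′)
                  (allMaps (nV G) (nV H)))

-- Symmetric functions, represented by their coefficients in the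
-- monomial basis m_λ (indexed by partitions λ, as lists).

SymFn : Set
SymFn = List ℕ → ℕ

mult : List ℕ → ℕ → ℕ
mult λ′ i = length (filterᵇ (λ k → k ≡ᵇ i) λ′)

-- multinomial N! / (r_1! r_2! … r_k! (N - Σ r)!), computed as a product of
-- binomials (equal to 0 when Σ r > N)
multinomial : ℕ → List ℕ → ℕ
multinomial N []       = 1
multinomial N (r ∷ rs) = (N C r) * multinomial (N ∸ r) rs

-- coefficient c with m_λ^N = c · m_λ, i.e.
-- N! / (r_1(λ)! r_2(λ)! … (N - ℓ(λ))!)
mNcoeff : ℕ → List ℕ → ℕ
mNcoeff N λ′ = multinomial N (map (λ i → mult λ′ (suc i)) (upTo (sum λ′)))

-- X_G^H = Σ_λ d_λ m_λ^{|V(H)|}, as its monomial-basis coefficients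
X : (G H : Graph) → SymFn
X G H λ′ = d G H λ′ * mNcoeff (nV H) λ′

Xself : Graph → SymFn
Xself G = X G G

{-# OPTIONS --safe #-}

-- A self-homomorphism of a tree T whose image has two points folds T onto an edge, so its type
-- is the bipartition (a, b) of T; one whose image has three points folds T onto a cherry u – v – w,
-- sending one colour class to v and the other onto {u, w}, and each cherry receives
-- (2^a − 2) + (2^b − 2) such foldings. Hence X_T^T determines |V(T)|, 2^a + 2^b and, through its
-- coefficients of types of length 3, the number Σ_v deg v (deg v − 1) of cherries. For a spider
-- with k legs and n − 1 edges this number is k (k − 1) + 2 (n − 1 − k), and k ↦ k² − 3k is
-- injective on k ≥ 2.

module Submission where

open import Defs
open import Data.Nat using (ℕ; zero; suc; >-nonZero; _+_; _*_; _∸_; _^_; _≤_; _<_; _≡ᵇ_; _≤ᵇ_; z≤n; s≤s)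
open import Data.Nat.Properties
open import Data.Nat.ListAction using (sum)
open import Data.Nat.ListAction.Properties using (sum-↭)
open import Data.Nat.Combinatorics using (_C_; nCk+nC[k+1]≡[n+1]C[k+1])
open import Data.Nat.Tactic.RingSolver using (solve-∀)
import Data.Bool as Bool
open import Data.Bool using (Bool; true; false; T; T?; _∧_; _∨_; not; _xor_; if_then_else_)
open import Data.Bool.Properties
  using ( ∧-idem; ∧-zeroʳ; ∧-identityʳ; ∧-conicalˡ; ∧-conicalʳ; ∨-identityʳ; ∨-zeroʳ; ∨-comm
        ; not-involutive; not-¬; not-distribˡ-xor; not-distribʳ-xor
        ; xor-annihilates-not; xor-same; xor-inverseˡ; xor-inverseʳ; xor-identityʳ; xor-comm)
open import Data.Bool.ListAction using (all; any)
open import Data.Fin using (Fin; zero; suc; toℕ; fromℕ<)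
open import Data.Fin.Properties using (toℕ-fromℕ<; toℕ<n) renaming (_≟_ to _≟ᶠ_)
open import Data.List using (List; []; _∷_; _++_; length; map; concatMap; filter; filterᵇ; tabulate; allFin; applyUpTo; upTo)
open import Data.List.Properties using (filter-++; length-++; map-∘; map-id; map-tabulate)
open import Data.List.Relation.Unary.All using (All; []; _∷_)
import Data.List.Relation.Unary.All.Properties as All
open import Data.List.Relation.Binary.Permutation.Propositional
  using (_↭_; prep; swap; ↭-sym) renaming (refl to ↭-refl; trans to ↭-trans)
open import Data.List.Relation.Binary.Permutation.Propositional.Properties using (map⁺; ↭-length; All-resp-↭)
open import Data.Vec using (Vec; []; _∷_; lookup)
import Data.Vec as Vec
open import Data.Vec.Properties using (lookup∘tabulate)
open import Data.Product using (∃-syntax; _×_; _,_; proj₁; proj₂)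
open import Data.Sum using (_⊎_; inj₁; inj₂) renaming (swap to ⊎-swap)
open import Data.Empty using (⊥; ⊥-elim)
open import Data.Unit using (tt)
open import Function using (_∘_; id)
open import Relation.Nullary using (Dec; does; yes; no)
open import Relation.Nullary.Decidable using (dec-true; dec-false)
open import Relation.Unary using (Pred; Decidable)
open import Relation.Binary.PropositionalEquality
open import Relation.Binary.Definitions using (tri<; tri≈; tri>)
open import Algebra.Properties.Semiring.Sum +-*-semiring
  using (sum-syntax; sum-cong-≗; sum-replicate-zero; ∑-distrib-+; ∑-comm; *-distribˡ-sum; *-distribʳ-sum)
  renaming (sum to ∑)
open import Algebra.Properties.Monoid.Sum *-1-monoid using () renaming (sum to ∏; sum-cong-≗ to ∏-cong-≗)

m*n>0 : ∀ {m n} → 0 < m → 0 < n → 0 < m * n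
m*n>0 {suc m} {suc n} _ _ = s≤s z≤n

m*n>0⇒m>0 : ∀ {m n} → 0 < m * n → 0 < m
m*n>0⇒m>0 {suc m} _ = s≤s z≤n

m*n>0⇒n>0 : ∀ {m n} → 0 < m * n → 0 < n
m*n>0⇒n>0 {m} {suc n} _ = s≤s z≤n
m*n>0⇒n>0 {m} {zero}  m*0>0 rewrite *-zeroʳ m = m*0>0

2^[2+k]∸2>0 : ∀ k → 0 < 2 ^ (2 + k) ∸ 2
2^[2+k]∸2>0 k = m<n⇒0<n∸m (≤-trans (s≤s (s≤s (s≤s z≤n))) (^-monoʳ-≤ 2 {2} {2 + k} (s≤s (s≤s z≤n))))

2^a∸2+2^b∸2>0 : ∀ {a b} → 1 ≤ a → 1 ≤ b → 3 ≤ a + b → 0 < (2 ^ a ∸ 2) + (2 ^ b ∸ 2)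
2^a∸2+2^b∸2>0 {suc zero}    {suc (suc b)} _ _ _ = ≤-trans (2^[2+k]∸2>0 b) (m≤n+m _ _)
2^a∸2+2^b∸2>0 {suc (suc a)} {_}           _ _ _ = ≤-trans (2^[2+k]∸2>0 a) (m≤m+n _ _)
2^a∸2+2^b∸2>0 {suc zero}    {suc zero}    _ _ (s≤s (s≤s ()))

⟦_⟧ : Bool → ℕ
⟦ true ⟧  = 1
⟦ false ⟧ = 0

⟦⟧-∧ : ∀ a b → ⟦ a ∧ b ⟧ ≡ ⟦ a ⟧ * ⟦ b ⟧
⟦⟧-∧ true  b = sym (+-identityʳ ⟦ b ⟧)
⟦⟧-∧ false b = refl

⟦⟧-∨ : ∀ a b → (a ≡ true → b ≡ false) → ⟦ a ∨ b ⟧ ≡ ⟦ a ⟧ + ⟦ b ⟧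
⟦⟧-∨ true  b excl rewrite excl refl = refl
⟦⟧-∨ false b excl = refl

⟦not⟧+⟦⟧ : ∀ a → ⟦ not a ⟧ + ⟦ a ⟧ ≡ 1
⟦not⟧+⟦⟧ true  = refl
⟦not⟧+⟦⟧ false = refl

⟦⟧-split-∨ : ∀ a p q → (a ≡ true → (p ∨ q) ≡ true) → ⟦ a ⟧ ≡ ⟦ a ∧ p ∧ q ⟧ + ⟦ a ∧ not p ⟧ + ⟦ a ∧ not q ⟧
⟦⟧-split-∨ false p     q     _ = refl
⟦⟧-split-∨ true  true  true  _ = refl
⟦⟧-split-∨ true  true  false _ = refl
⟦⟧-split-∨ true  false true  _ = refl
⟦⟧-split-∨ true  false false a⇒p∨q with () ← a⇒p∨q refl

⟦⟧≤1 : ∀ a → ⟦ a ⟧ ≤ 1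
⟦⟧≤1 true  = s≤s z≤n
⟦⟧≤1 false = z≤n

⟦⟧≡0⇒false : ∀ {a} → ⟦ a ⟧ ≡ 0 → a ≡ false
⟦⟧≡0⇒false {false} _ = refl

⟦⟧>0⇒true : ∀ {a} → 0 < ⟦ a ⟧ → a ≡ true
⟦⟧>0⇒true {true} _ = refl

true≢false : true ≢ false
true≢false ()

xor-solveˡ : ∀ {s c k} → s xor c ≡ k → s ≡ k xor c
xor-solveˡ {false} {false} refl = refl
xor-solveˡ {false} {true}  refl = refl
xor-solveˡ {true}  {false} refl = refl
xor-solveˡ {true}  {true}  refl = refl

xor-not-xor : ∀ k b → k xor b ≡ not (b xor not k)
xor-not-xor false false = refl
xor-not-xor false true  = refl
xor-not-xor true  false = refl
xor-not-xor true  true  = refl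

xor-flip : ∀ {b c c′} → c ≢ c′ → b xor c ≡ true → b xor c′ ≡ false
xor-flip {false} {false} {false} c≢c′ _ = ⊥-elim (c≢c′ refl)
xor-flip {false} {false} {true}  c≢c′ ()
xor-flip {false} {true}  {false} c≢c′ _ = refl
xor-flip {false} {true}  {true}  c≢c′ _ = ⊥-elim (c≢c′ refl)
xor-flip {true}  {false} {false} c≢c′ _ = ⊥-elim (c≢c′ refl)
xor-flip {true}  {false} {true}  c≢c′ _ = refl
xor-flip {true}  {true}  {_}     c≢c′ ()

not≡true : ∀ {b} → not b ≡ true → b ≡ false
not≡true {false} _ = refl

Bool-ext : ∀ {a b} → (a ≡ true → b ≡ true) → (b ≡ true → a ≡ true) → a ≡ b
Bool-ext {true}  a⇒b _   = sym (a⇒b refl)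
Bool-ext {false} {true}  _ b⇒a = b⇒a refl
Bool-ext {false} {false} _ _   = refl

infix 7 _==_

_==_ : ∀ {k} → Fin k → Fin k → Bool
a == b = does (a ≟ᶠ b)

==-refl : ∀ {k} (a : Fin k) → (a == a) ≡ true
==-refl a = dec-true (a ≟ᶠ a) refl

==-sound : ∀ {k} {a b : Fin k} → (a == b) ≡ true → a ≡ b
==-sound {a = a} {b} e with a ≟ᶠ b
... | yes a≡b = a≡b

==-false : ∀ {k} {a b : Fin k} → a ≢ b → (a == b) ≡ false
==-false {a = a} {b} = dec-false (a ≟ᶠ b)

==-false⇒≢ : ∀ {k} {a b : Fin k} → (a == b) ≡ false → a ≢ b
==-false⇒≢ {a = a} e refl = true≢false (trans (sym (==-refl a)) e)

==-sym : ∀ {k} (a b : Fin k) → (a == b) ≡ (b == a)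
==-sym a b with a ≟ᶠ b | b ≟ᶠ a
... | yes _   | yes _   = refl
... | no  _   | no  _   = refl
... | yes a≡b | no  b≢a = ⊥-elim (b≢a (sym a≡b))
... | no  a≢b | yes b≡a = ⊥-elim (a≢b (sym b≡a))

==-∨-sound : ∀ {k} {z a b : Fin k} → (z == a ∨ z == b) ≡ true → z ≡ a ⊎ z ≡ b
==-∨-sound {z = z} {a} e with z == a in ea
... | true  = inj₁ (==-sound ea)
... | false = inj₂ (==-sound e)

==-∨-complete : ∀ {k} {z a b : Fin k} → z ≡ a ⊎ z ≡ b → (z == a ∨ z == b) ≡ true
==-∨-complete {a = a} (inj₁ refl) rewrite ==-refl a = refl
==-∨-complete {z = z} (inj₂ refl) = trans (cong (z == _ ∨_) (==-refl z)) (∨-zeroʳ _)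

==-∨-sound₃ : ∀ {k} {z a b c : Fin k} → (z == a ∨ z == b ∨ z == c) ≡ true → z ≡ a ⊎ z ≡ b ⊎ z ≡ c
==-∨-sound₃ {z = z} {a} e with z == a in ea
... | true  = inj₁ (==-sound ea)
... | false = inj₂ (==-∨-sound e)

==-other : ∀ {k} {a b x : Fin k} → a ≢ b → x ≡ a ⊎ x ≡ b → (x == b) ≡ not (x == a)
==-other {a = a} {b} a≢b (inj₁ refl) rewrite ==-refl a = ==-false a≢b
==-other {a = a} {b} a≢b (inj₂ refl) rewrite ==-refl b | ==-false (≢-sym a≢b) = refl

two-valued : ∀ {k} {a b x y : Fin k} → a ≢ b → x ≡ a ⊎ x ≡ b → y ≡ a ⊎ y ≡ b → x ≢ y → (x == a) ≡ not (y == a)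
two-valued         a≢b (inj₁ refl) (inj₁ refl) x≢y = ⊥-elim (x≢y refl)
two-valued         a≢b (inj₂ refl) (inj₂ refl) x≢y = ⊥-elim (x≢y refl)
two-valued {a = a} a≢b (inj₁ refl) (inj₂ refl) _ rewrite ==-refl a | ==-false (≢-sym a≢b) = refl
two-valued {a = a} a≢b (inj₂ refl) (inj₁ refl) _ rewrite ==-refl a | ==-false (≢-sym a≢b) = refl

≡ᵇ-refl : ∀ n → (n ≡ᵇ n) ≡ true
≡ᵇ-refl zero    = refl
≡ᵇ-refl (suc n) = ≡ᵇ-refl n

≡ᵇ-false : ∀ {m n} → m ≢ n → (m ≡ᵇ n) ≡ false
≡ᵇ-false {m} {n} m≢n with m ≡ᵇ n in e
... | false = refl
... | true  = ⊥-elim (m≢n (≡ᵇ⇒≡ m n (subst T (sym e) tt)))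

≡ᵇ-sym : ∀ m n → (m ≡ᵇ n) ≡ (n ≡ᵇ m)
≡ᵇ-sym zero    zero    = refl
≡ᵇ-sym zero    (suc n) = refl
≡ᵇ-sym (suc m) zero    = refl
≡ᵇ-sym (suc m) (suc n) = ≡ᵇ-sym m n

∑-zero : ∀ {n} (g : Fin n → ℕ) → (∀ i → g i ≡ 0) → ∑ g ≡ 0
∑-zero {n} g g≡0 = trans (sum-cong-≗ g≡0) (sum-replicate-zero n)

∑-one : ∀ n → ∑[ i < n ] 1 ≡ n
∑-one zero    = refl
∑-one (suc n) = cong suc (∑-one n)

∑-*ˡ : ∀ {n} c (g : Fin n → ℕ) → ∑[ i < n ] (c * g i) ≡ c * ∑ g
∑-*ˡ c g = sym (*-distribˡ-sum c g)

∑-*ʳ : ∀ {n} c (g : Fin n → ℕ) → ∑[ i < n ] (g i * c) ≡ ∑ g * c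
∑-*ʳ c g = sym (*-distribʳ-sum c g)

∑-δ : ∀ {n} (a : Fin n) (g : Fin n → ℕ) → ∑[ i < n ] (⟦ i == a ⟧ * g i) ≡ g a
∑-δ {suc n} zero g = trans (cong (g zero + 0 +_) (∑-zero {n} _ (λ _ → refl))) (trans (+-identityʳ _) (+-identityʳ _))
∑-δ {suc n} (suc a) g = ∑-δ a (g ∘ suc)

∑-δ₁ : ∀ {n} (a : Fin n) → ∑[ i < n ] ⟦ i == a ⟧ ≡ 1
∑-δ₁ a = trans (sum-cong-≗ (λ i → sym (*-identityʳ ⟦ i == a ⟧))) (∑-δ a (λ _ → 1))

∑-mono : ∀ {n} {g h : Fin n → ℕ} → (∀ i → g i ≤ h i) → ∑ g ≤ ∑ h
∑-mono {zero}  g≤h = z≤n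
∑-mono {suc n} g≤h = +-mono-≤ (g≤h zero) (∑-mono (g≤h ∘ suc))

∑>0 : ∀ {n} (g : Fin n → ℕ) → 0 < ∑ g → ∃[ i ] 0 < g i
∑>0 {suc n} g ∑>0′ with g zero in e
... | suc _ = zero , subst (0 <_) (sym e) (s≤s z≤n)
... | zero  = let i , gi>0 = ∑>0 (g ∘ suc) ∑>0′ in suc i , gi>0

∑-two-support : ∀ {n} (g : Fin n → ℕ) {a b} → a ≢ b → (∀ w → w ≢ a → w ≢ b → g w ≡ 0) → ∑ g ≡ g a + g b
∑-two-support {n} g {a} {b} a≢b outside = begin
    ∑ g                                                      ≡⟨ sum-cong-≗ split ⟩
    ∑[ w < n ] (⟦ w == a ⟧ * g a + ⟦ w == b ⟧ * g b)         ≡⟨ ∑-distrib-+ (λ w → ⟦ w == a ⟧ * g a) (λ w → ⟦ w == b ⟧ * g b) ⟩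
    ∑[ w < n ] (⟦ w == a ⟧ * g a) + ∑[ w < n ] (⟦ w == b ⟧ * g b)
      ≡⟨ cong₂ _+_ (trans (∑-*ʳ (g a) (λ w → ⟦ w == a ⟧)) (cong (_* g a) (∑-δ₁ a)))
                   (trans (∑-*ʳ (g b) (λ w → ⟦ w == b ⟧)) (cong (_* g b) (∑-δ₁ b))) ⟩
    1 * g a + 1 * g b                                        ≡⟨ cong₂ _+_ (*-identityˡ (g a)) (*-identityˡ (g b)) ⟩
    g a + g b                                                ∎
  where
  open ≡-Reasoning
  split : ∀ w → g w ≡ ⟦ w == a ⟧ * g a + ⟦ w == b ⟧ * g b
  split w with w == a in ea | w == b in eb
  ... | true  | true  = ⊥-elim (a≢b (trans (sym (==-sound {a = w} ea)) (==-sound {a = w} eb)))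
  ... | true  | false = trans (cong g (==-sound {a = w} ea)) (sym (trans (+-identityʳ (g a + 0)) (+-identityʳ (g a))))
  ... | false | true  = trans (cong g (==-sound {a = w} eb)) (sym (+-identityʳ (g b)))
  ... | false | false = outside w (==-false⇒≢ {a = w} ea) (==-false⇒≢ {a = w} eb)

term≤∑ : ∀ {n} (g : Fin n → ℕ) a → g a ≤ ∑ g
term≤∑ g zero    = m≤m+n _ _
term≤∑ g (suc a) = ≤-trans (term≤∑ (g ∘ suc) a) (m≤n+m _ _)

count : ∀ {n} → (Fin n → Bool) → ℕ
count {n} p = ∑[ i < n ] ⟦ p i ⟧

count≤ : ∀ {n} (p : Fin n → Bool) → count p ≤ n
count≤ {zero}  p = z≤n
count≤ {suc n} p = +-mono-≤ (⟦⟧≤1 (p zero)) (count≤ (p ∘ suc))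

count≡0 : ∀ {n} (p : Fin n → Bool) → count p ≡ 0 → ∀ i → p i ≡ false
count≡0 p c≡0 i = ⟦⟧≡0⇒false (n≤0⇒n≡0 (subst (⟦ p i ⟧ ≤_) c≡0 (term≤∑ (⟦_⟧ ∘ p) i)))

count>0 : ∀ {n} (p : Fin n → Bool) → 0 < count p → ∃[ a ] p a ≡ true
count>0 p c>0 = let a , pa>0 = ∑>0 (⟦_⟧ ∘ p) c>0 in a , ⟦⟧>0⇒true pa>0

_∖_ : ∀ {n} → (Fin n → Bool) → Fin n → Fin n → Bool
(p ∖ a) z = p z ∧ not (z == a)

∖-≢ : ∀ {n} (p : Fin n → Bool) {a z} → (p ∖ a) z ≡ true → z ≢ a
∖-≢ p {a} {z} e z≡a with z == a in eq
... | false = ==-false⇒≢ eq z≡a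
... | true  = true≢false (trans (sym e) (∧-zeroʳ (p z)))

∖-⊆ : ∀ {n} (p : Fin n → Bool) {a z} → (p ∖ a) z ≡ true → p z ≡ true
∖-⊆ p {a} {z} e with p z
... | true = refl

∖-split : ∀ {n} (p : Fin n → Bool) {a} → p a ≡ true → ∀ z → p z ≡ (z == a ∨ (p ∖ a) z)
∖-split p {a} pa z with z == a in eq
... | true  = subst (λ y → p y ≡ true) (sym (==-sound eq)) pa
... | false = sym (∧-identityʳ (p z))

count-∨-δ : ∀ {n} (q : Fin n → Bool) {a} → q a ≡ false → count (λ z → z == a ∨ q z) ≡ suc (count q)
count-∨-δ {n} q {a} qa≡false = begin
    ∑[ z < n ] ⟦ z == a ∨ q z ⟧        ≡⟨ sum-cong-≗ (λ z → ⟦⟧-∨ (z == a) (q z) (λ e → subst (λ y → q y ≡ false) (sym (==-sound e)) qa≡false))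
                                       ⟩
    ∑[ z < n ] (⟦ z == a ⟧ + ⟦ q z ⟧)  ≡⟨ ∑-distrib-+ (λ z → ⟦ z == a ⟧) (λ z → ⟦ q z ⟧) ⟩
    ∑[ z < n ] ⟦ z == a ⟧ + count q    ≡⟨ cong (_+ count q) (∑-δ₁ a) ⟩
    suc (count q)                      ∎
  where open ≡-Reasoning

count-∖ : ∀ {n} (p : Fin n → Bool) {a} → p a ≡ true → count p ≡ suc (count (p ∖ a))
count-∖ p {a} pa = trans (sum-cong-≗ (cong ⟦_⟧ ∘ ∖-split p pa)) (count-∨-δ (p ∖ a) (removed a))
  where
  removed : ∀ a → (p ∖ a) a ≡ false
  removed a = trans (cong (λ b → p a ∧ not b) (==-refl a)) (∧-zeroʳ (p a))

count-pick : ∀ {n} (p : Fin n → Bool) {m} → count p ≡ suc m → ∃[ a ] p a ≡ true × count (p ∖ a) ≡ m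
count-pick p c≡ =
  let a , pa = count>0 p (subst (0 <_) (sym c≡) (s≤s z≤n))
  in  a , pa , suc-injective (trans (sym (count-∖ p pa)) c≡)

∖-intro : ∀ {n} (p : Fin n → Bool) {a z} → p z ≡ true → z ≢ a → (p ∖ a) z ≡ true
∖-intro p {a} {z} pz z≢a rewrite pz | ==-false z≢a = refl

count≡2-≗ : ∀ {n} (p : Fin n → Bool) {a b} → count p ≡ 2 → p a ≡ true → p b ≡ true → a ≢ b →
            ∀ z → p z ≡ (z == a ∨ z == b)
count≡2-≗ p {a} {b} c≡2 pa pb a≢b z = begin
    p z                                ≡⟨ ∖-split p pa z ⟩
    z == a ∨ (p ∖ a) z                 ≡⟨ cong (z == a ∨_) (∖-split (p ∖ a) pb′ z) ⟩
    z == a ∨ z == b ∨ ((p ∖ a) ∖ b) z  ≡⟨ cong (λ x → z == a ∨ z == b ∨ x) (count≡0 _ c₀ z) ⟩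
    z == a ∨ z == b ∨ false            ≡⟨ cong (z == a ∨_) (∨-identityʳ (z == b)) ⟩
    z == a ∨ z == b                    ∎
  where
  open ≡-Reasoning
  pb′ : (p ∖ a) b ≡ true
  pb′ = ∖-intro p pb (≢-sym a≢b)
  c₀ : count ((p ∖ a) ∖ b) ≡ 0
  c₀ = suc-injective (trans (sym (count-∖ (p ∖ a) pb′)) (suc-injective (trans (sym (count-∖ p pa)) c≡2)))

count≡3-≗ : ∀ {n} (p : Fin n → Bool) {a b} → count p ≡ 3 → p a ≡ true → p b ≡ true → a ≢ b →
            ∃[ c ] c ≢ a × c ≢ b × p c ≡ true × (∀ z → p z ≡ (z == a ∨ z == b ∨ z == c))
count≡3-≗ p {a} {b} c≡3 pa pb a≢b = third (count-pick ((p ∖ a) ∖ b) c₁)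
  where
  open ≡-Reasoning
  pb′ : (p ∖ a) b ≡ true
  pb′ = ∖-intro p pb (≢-sym a≢b)
  c₁ : count ((p ∖ a) ∖ b) ≡ 1
  c₁ = suc-injective (trans (sym (count-∖ (p ∖ a) pb′)) (suc-injective (trans (sym (count-∖ p pa)) c≡3)))
  third : ∃[ c ] ((p ∖ a) ∖ b) c ≡ true × count (((p ∖ a) ∖ b) ∖ c) ≡ 0 →
          ∃[ c ] c ≢ a × c ≢ b × p c ≡ true × (∀ z → p z ≡ (z == a ∨ z == b ∨ z == c))
  third (c , pc , c₀) = c , ∖-≢ p (∖-⊆ (p ∖ a) pc) , ∖-≢ (p ∖ a) pc , ∖-⊆ p (∖-⊆ (p ∖ a) pc) , λ z → begin
    p z                                               ≡⟨ ∖-split p pa z ⟩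
    z == a ∨ (p ∖ a) z                                ≡⟨ cong (z == a ∨_) (∖-split (p ∖ a) pb′ z) ⟩
    z == a ∨ z == b ∨ ((p ∖ a) ∖ b) z                 ≡⟨ cong (λ x → z == a ∨ z == b ∨ x) (∖-split _ pc z) ⟩
    z == a ∨ z == b ∨ z == c ∨ (((p ∖ a) ∖ b) ∖ c) z  ≡⟨ cong (λ x → z == a ∨ z == b ∨ z == c ∨ x) (count≡0 _ c₀ z) ⟩
    z == a ∨ z == b ∨ z == c ∨ false                  ≡⟨ cong (λ x → z == a ∨ z == b ∨ x) (∨-identityʳ (z == c)) ⟩
    z == a ∨ z == b ∨ z == c                          ∎

count-three : ∀ {k} {a b c : Fin k} → a ≢ b → a ≢ c → b ≢ c → count (λ z → z == a ∨ z == b ∨ z == c) ≡ 3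
count-three {a = a} {b} {c} a≢b a≢c b≢c =
  trans (count-∨-δ (λ z → z == b ∨ z == c) (cong₂ _∨_ (==-false a≢b) (==-false a≢c)))
        (cong suc (trans (count-∨-δ (_== c) (==-false b≢c)) (cong suc (∑-δ₁ c))))

∑-distinct-pairs : ∀ {n} (p : Fin n → Bool) →
                   ∑[ u < n ] ∑[ w < n ] ⟦ p u ∧ p w ∧ not (u == w) ⟧ + count p ≡ count p * count p
∑-distinct-pairs {n} p = begin
    ∑[ u < n ] ∑[ w < n ] ⟦ p u ∧ p w ∧ not (u == w) ⟧ + count p
  ≡⟨ sym (∑-distrib-+ (λ u → ∑[ w < n ] ⟦ p u ∧ p w ∧ not (u == w) ⟧) (⟦_⟧ ∘ p)) ⟩
    ∑[ u < n ] (∑[ w < n ] ⟦ p u ∧ p w ∧ not (u == w) ⟧ + ⟦ p u ⟧)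
  ≡⟨ sum-cong-≗ row ⟩
    ∑[ u < n ] (⟦ p u ⟧ * count p)
  ≡⟨ ∑-*ʳ (count p) (⟦_⟧ ∘ p) ⟩
    count p * count p
  ∎
  where
  open ≡-Reasoning
  split : ∀ a b e → ⟦ a ∧ b ∧ not e ⟧ + ⟦ e ⟧ * ⟦ a ∧ b ⟧ ≡ ⟦ a ⟧ * ⟦ b ⟧
  split true  true  true  = refl
  split true  true  false = refl
  split true  false e     = *-zeroʳ ⟦ e ⟧
  split false b     e     = *-zeroʳ ⟦ e ⟧
  row : ∀ u → ∑[ w < n ] ⟦ p u ∧ p w ∧ not (u == w) ⟧ + ⟦ p u ⟧ ≡ ⟦ p u ⟧ * count p
  row u = begin
      ∑[ w < n ] ⟦ p u ∧ p w ∧ not (u == w) ⟧ + ⟦ p u ⟧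
    ≡⟨ cong (∑[ w < n ] ⟦ p u ∧ p w ∧ not (u == w) ⟧ +_)
            (sym (trans (∑-δ u (λ w → ⟦ p u ∧ p w ⟧)) (cong ⟦_⟧ (∧-idem (p u))))) ⟩
      ∑[ w < n ] ⟦ p u ∧ p w ∧ not (u == w) ⟧ + ∑[ w < n ] (⟦ w == u ⟧ * ⟦ p u ∧ p w ⟧)
    ≡⟨ sym (∑-distrib-+ (λ w → ⟦ p u ∧ p w ∧ not (u == w) ⟧) (λ w → ⟦ w == u ⟧ * ⟦ p u ∧ p w ⟧)) ⟩
      ∑[ w < n ] (⟦ p u ∧ p w ∧ not (u == w) ⟧ + ⟦ w == u ⟧ * ⟦ p u ∧ p w ⟧)
    ≡⟨ sum-cong-≗ (λ w → trans (cong (λ e → ⟦ p u ∧ p w ∧ not (u == w) ⟧ + ⟦ e ⟧ * ⟦ p u ∧ p w ⟧) (==-sym w u))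
                               (split (p u) (p w) (u == w))) ⟩
      ∑[ w < n ] (⟦ p u ⟧ * ⟦ p w ⟧)
    ≡⟨ ∑-*ˡ ⟦ p u ⟧ (⟦_⟧ ∘ p) ⟩
      ⟦ p u ⟧ * count p
    ∎

orderedPair : ∀ {n} → Fin n → Fin n → Fin n → Fin n → Bool
orderedPair a b u w = (u == a ∧ w == b) ∨ (u == b ∧ w == a)

orderedPair-sound : ∀ {n} {a b u w : Fin n} → orderedPair a b u w ≡ true → u ≡ a × w ≡ b ⊎ u ≡ b × w ≡ a
orderedPair-sound {a = a} {b} {u} {w} e with u == a in ua | w == b in wb
... | true | true = inj₁ (==-sound ua , ==-sound wb)
... | true | false = inj₂ (==-sound (∧-conicalˡ (u == b) (w == a) e) , ==-sound (∧-conicalʳ (u == b) (w == a) e))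
... | false | _ = inj₂ (==-sound (∧-conicalˡ (u == b) (w == a) e) , ==-sound (∧-conicalʳ (u == b) (w == a) e))

orderedPair-complete : ∀ {n} {a b u w : Fin n} → u ≡ a × w ≡ b ⊎ u ≡ b × w ≡ a → orderedPair a b u w ≡ true
orderedPair-complete {a = a} {b} (inj₁ (refl , refl)) rewrite ==-refl a | ==-refl b = refl
orderedPair-complete {a = a} {b} (inj₂ (refl , refl)) rewrite ==-refl a | ==-refl b = ∨-zeroʳ _

∑-orderedPair : ∀ {n} {a b : Fin n} → a ≢ b → ∑[ u < n ] ∑[ w < n ] ⟦ orderedPair a b u w ⟧ ≡ 2
∑-orderedPair {n} {a} {b} a≢b = begin
    ∑[ u < n ] ∑[ w < n ] ⟦ orderedPair a b u w ⟧
  ≡⟨ ∑-two-support (λ u → ∑[ w < n ] ⟦ orderedPair a b u w ⟧) a≢b outside ⟩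
    ∑[ w < n ] ⟦ orderedPair a b a w ⟧ + ∑[ w < n ] ⟦ orderedPair a b b w ⟧
  ≡⟨ cong₂ _+_ (trans (sum-cong-≗ at-a) (∑-δ₁ b)) (trans (sum-cong-≗ at-b) (∑-δ₁ a)) ⟩
    2
  ∎
  where
  open ≡-Reasoning
  outside : ∀ u → u ≢ a → u ≢ b → ∑[ w < n ] ⟦ orderedPair a b u w ⟧ ≡ 0
  outside u u≢a u≢b = ∑-zero _ (λ w → cong ⟦_⟧ (cong₂ (λ x y → (x ∧ w == b) ∨ (y ∧ w == a)) (==-false u≢a) (==-false u≢b)))
  at-a : ∀ w → ⟦ orderedPair a b a w ⟧ ≡ ⟦ w == b ⟧
  at-a w rewrite ==-refl a | ==-false a≢b = cong ⟦_⟧ (∨-identityʳ (w == b))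
  at-b : ∀ w → ⟦ orderedPair a b b w ⟧ ≡ ⟦ w == a ⟧
  at-b w rewrite ==-refl b | ==-false (≢-sym a≢b) = refl

allᶠ : ∀ {n} → (Fin n → Bool) → Bool
allᶠ {zero}  p = true
allᶠ {suc n} p = p zero ∧ allᶠ (p ∘ suc)

allᶠ-sound : ∀ {n} (p : Fin n → Bool) → allᶠ p ≡ true → ∀ i → p i ≡ true
allᶠ-sound p all≡ zero    with p zero
... | true = refl
allᶠ-sound p all≡ (suc i) with p zero
... | true = allᶠ-sound (p ∘ suc) all≡ i

allᶠ-complete : ∀ {n} (p : Fin n → Bool) → (∀ i → p i ≡ true) → allᶠ p ≡ true
allᶠ-complete {zero}  p _  = refl
allᶠ-complete {suc n} p ps rewrite ps zero = allᶠ-complete (p ∘ suc) (ps ∘ suc)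

all-tabulate : ∀ {a} {A : Set a} (p : A → Bool) {j} (t : Fin j → A) → all p (tabulate t) ≡ allᶠ (p ∘ t)
all-tabulate p {zero}  t = refl
all-tabulate p {suc j} t = cong (p (t zero) ∧_) (all-tabulate p (t ∘ suc))

sumMaps : ∀ {k m} → (Vec (Fin m) k → ℕ) → ℕ
sumMaps {zero}      g = g []
sumMaps {suc k} {m} g = ∑[ x < m ] sumMaps (λ f → g (x ∷ f))

length-filterᵇ-maps : ∀ k m (p : Vec (Fin m) k → Bool) → length (filterᵇ p (allMaps k m)) ≡ sumMaps (⟦_⟧ ∘ p)
length-filterᵇ-maps zero    m p with p []
... | true  = refl
... | false = refl
length-filterᵇ-maps (suc k) m p = over id
  where
  extend : Fin m → List (Vec (Fin m) (suc k))
  extend x = map (x ∷_) (allMaps k m)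
  extend-count : ∀ x → length (filterᵇ p (extend x)) ≡ sumMaps (λ f → ⟦ p (x ∷ f) ⟧)
  extend-count x = trans (prefixed (allMaps k m)) (length-filterᵇ-maps k m (p ∘ (x ∷_)))
    where
    prefixed : ∀ fs → length (filterᵇ p (map (x ∷_) fs)) ≡ length (filterᵇ (p ∘ (x ∷_)) fs)
    prefixed []       = refl
    prefixed (f ∷ fs) with p (x ∷ f)
    ... | true  = cong suc (prefixed fs)
    ... | false = prefixed fs
  over : ∀ {j} (t : Fin j → Fin m) →
         length (filterᵇ p (concatMap extend (tabulate t))) ≡ ∑[ i < j ] sumMaps (λ f → ⟦ p (t i ∷ f) ⟧)
  over {zero}  t = refl
  over {suc j} t = begin
      length (filterᵇ p (extend (t zero) ++ concatMap extend (tabulate (t ∘ suc))))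
    ≡⟨ cong length (filter-++ (T? ∘ p) (extend (t zero)) _) ⟩
      length (filterᵇ p (extend (t zero)) ++ filterᵇ p (concatMap extend (tabulate (t ∘ suc))))
    ≡⟨ length-++ (filterᵇ p (extend (t zero))) ⟩
      length (filterᵇ p (extend (t zero))) + length (filterᵇ p (concatMap extend (tabulate (t ∘ suc))))
    ≡⟨ cong₂ _+_ (extend-count (t zero)) (over (t ∘ suc)) ⟩
      ∑[ i < suc j ] sumMaps (λ f → ⟦ p (t i ∷ f) ⟧)
    ∎
    where open ≡-Reasoning

sumMaps-cong : ∀ {k m} {g h : Vec (Fin m) k → ℕ} → (∀ f → g f ≡ h f) → sumMaps g ≡ sumMaps h
sumMaps-cong {zero}  g≗h = g≗h []
sumMaps-cong {suc k} {m} g≗h = sum-cong-≗ {m} (λ x → sumMaps-cong (λ f → g≗h (x ∷ f)))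

sumMaps-+ : ∀ {k m} (g h : Vec (Fin m) k → ℕ) → sumMaps (λ f → g f + h f) ≡ sumMaps g + sumMaps h
sumMaps-+ {zero}  g h = refl
sumMaps-+ {suc k} {m} g h =
  trans (sum-cong-≗ {m} (λ x → sumMaps-+ (λ f → g (x ∷ f)) (λ f → h (x ∷ f))))
        (∑-distrib-+ (λ x → sumMaps (λ f → g (x ∷ f))) (λ x → sumMaps (λ f → h (x ∷ f))))

sumMaps-*ˡ : ∀ {k m} c (g : Vec (Fin m) k → ℕ) → sumMaps (λ f → c * g f) ≡ c * sumMaps g
sumMaps-*ˡ {zero}  c g = refl
sumMaps-*ˡ {suc k} {m} c g =
  trans (sum-cong-≗ {m} (λ x → sumMaps-*ˡ c (λ f → g (x ∷ f)))) (∑-*ˡ c (λ x → sumMaps (λ f → g (x ∷ f))))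

sumMaps-∑ : ∀ {k m j} (g : Vec (Fin m) k → Fin j → ℕ) →
            sumMaps (λ f → ∑[ i < j ] g f i) ≡ ∑[ i < j ] sumMaps (λ f → g f i)
sumMaps-∑ {zero}  g = refl
sumMaps-∑ {suc k} {m} g =
  trans (sum-cong-≗ {m} (λ x → sumMaps-∑ (λ f → g (x ∷ f)))) (∑-comm (λ x i → sumMaps (λ f → g (x ∷ f) i)))

term≤sumMaps : ∀ {k m} (g : Vec (Fin m) k → ℕ) f → g f ≤ sumMaps g
term≤sumMaps g []      = ≤-refl
term≤sumMaps g (x ∷ f) = ≤-trans (term≤sumMaps (λ f′ → g (x ∷ f′)) f) (term≤∑ _ x)

sumMaps>0 : ∀ {k m} (g : Vec (Fin m) k → ℕ) → 0 < sumMaps g → ∃[ f ] 0 < g f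
sumMaps>0 {zero}  g g>0 = [] , g>0
sumMaps>0 {suc k} g g>0 =
  let x , gx>0 = ∑>0 _ g>0
      f , gf>0 = sumMaps>0 (λ f → g (x ∷ f)) gx>0
  in  x ∷ f , gf>0

sumMaps-allᶠ : ∀ {k m} (ok : Fin k → Fin m → Bool) →
               sumMaps (λ f → ⟦ allᶠ (λ i → ok i (lookup f i)) ⟧) ≡ ∏ (λ i → count (ok i))
sumMaps-allᶠ {zero}      ok = refl
sumMaps-allᶠ {suc k} {m} ok = begin
    ∑[ x < m ] sumMaps (λ f → ⟦ ok zero x ∧ rest f ⟧)
  ≡⟨ sum-cong-≗ (λ x → sumMaps-cong (λ f → ⟦⟧-∧ (ok zero x) (rest f))) ⟩
    ∑[ x < m ] sumMaps (λ f → ⟦ ok zero x ⟧ * ⟦ rest f ⟧)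
  ≡⟨ sum-cong-≗ (λ x → trans (sumMaps-*ˡ ⟦ ok zero x ⟧ (⟦_⟧ ∘ rest))
                             (cong (⟦ ok zero x ⟧ *_) (sumMaps-allᶠ (ok ∘ suc)))) ⟩
    ∑[ x < m ] (⟦ ok zero x ⟧ * ∏ (λ i → count (ok (suc i))))
  ≡⟨ ∑-*ʳ _ (λ x → ⟦ ok zero x ⟧) ⟩
    count (ok zero) * ∏ (λ i → count (ok (suc i)))
  ∎
  where
  open ≡-Reasoning
  rest : Vec (Fin m) k → Bool
  rest f = allᶠ (λ i → ok (suc i) (lookup f i))

∏-^ : ∀ {k} b (e : Fin k → ℕ) → ∏ (λ i → b ^ e i) ≡ b ^ ∑ e
∏-^ {zero}  b e = refl
∏-^ {suc k} b e = trans (cong (b ^ e zero *_) (∏-^ b (e ∘ suc))) (sym (^-distribˡ-+-* b (e zero) _))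

-- Fibres and the type of a map

length-filter-tabulate : ∀ {a p} {A : Set a} {P : Pred A p} (P? : Decidable P) {j} (t : Fin j → A) →
                         length (filter P? (tabulate t)) ≡ ∑[ i < j ] ⟦ does (P? (t i)) ⟧
length-filter-tabulate P? {zero}  t = refl
length-filter-tabulate P? {suc j} t with does (P? (t zero))
... | true  = cong suc (length-filter-tabulate P? (t ∘ suc))
... | false = length-filter-tabulate P? (t ∘ suc)

sum-map-tabulate : ∀ {a} {A : Set a} (h : A → ℕ) {j} (t : Fin j → A) → sum (map h (tabulate t)) ≡ ∑[ i < j ] h (t i)
sum-map-tabulate h {zero}  t = refl
sum-map-tabulate h {suc j} t = cong (h (t zero) +_) (sum-map-tabulate h (t ∘ suc))

nonzero : ℕ → Bool
nonzero s = not (s ≡ᵇ 0)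

sum-map-filter-nonzero : ∀ (h : ℕ → ℕ) → h 0 ≡ 0 → ∀ xs → sum (map h (filterᵇ nonzero xs)) ≡ sum (map h xs)
sum-map-filter-nonzero h h0≡0 []           = refl
sum-map-filter-nonzero h h0≡0 (zero  ∷ xs) = trans (sum-map-filter-nonzero h h0≡0 xs) (cong (_+ sum (map h xs)) (sym h0≡0))
sum-map-filter-nonzero h h0≡0 (suc x ∷ xs) = cong (h (suc x) +_) (sum-map-filter-nonzero h h0≡0 xs)

insertDesc-↭ : ∀ x xs → insertDesc x xs ↭ x ∷ xs
insertDesc-↭ x []       = ↭-refl
insertDesc-↭ x (y ∷ ys) with y ≤ᵇ x
... | true  = ↭-refl
... | false = ↭-trans (prep y (insertDesc-↭ x ys)) (swap y x ↭-refl)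

sortDesc-↭ : ∀ xs → sortDesc xs ↭ xs
sortDesc-↭ []       = ↭-refl
sortDesc-↭ (x ∷ xs) = ↭-trans (insertDesc-↭ x (sortDesc xs)) (prep x (sortDesc-↭ xs))

fibre : ∀ {k m} → (Fin k → Fin m) → Fin m → ℕ
fibre f w = count (λ x → f x == w)

inImage : ∀ {k m} → (Fin k → Fin m) → Fin m → Bool
inImage f w = nonzero (fibre f w)

imageSize : ∀ {k m} → (Fin k → Fin m) → ℕ
imageSize f = count (inImage f)

∑-fibre : ∀ {k m} (f : Fin k → Fin m) → ∑[ w < m ] fibre f w ≡ k
∑-fibre {k} {m} f = begin
    ∑[ w < m ] ∑[ x < k ] ⟦ f x == w ⟧  ≡⟨ ∑-comm (λ w x → ⟦ f x == w ⟧) ⟩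
    ∑[ x < k ] ∑[ w < m ] ⟦ f x == w ⟧  ≡⟨ sum-cong-≗ {k} (λ x → trans (sum-cong-≗ (λ w → cong ⟦_⟧ (==-sym (f x) w)))
                                                                     (∑-δ₁ (f x))) ⟩
    ∑[ x < k ] 1                        ≡⟨ ∑-one k ⟩
    k                                   ∎
  where open ≡-Reasoning

inImage≡false : ∀ {k m} (f : Fin k → Fin m) {w} → inImage f w ≡ false → fibre f w ≡ 0
inImage≡false f {w} e with fibre f w
... | zero = refl

inImage-intro : ∀ {k m} (f : Fin k → Fin m) x → inImage f (f x) ≡ true
inImage-intro f x with fibre f (f x) | term≤∑ (λ y → ⟦ f y == f x ⟧) x
... | suc _ | _ = refl
... | zero  | fx≤0 rewrite ==-refl (f x) = ⊥-elim (1+n≰n fx≤0)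

inImage-elim : ∀ {k m} (f : Fin k → Fin m) {w} → inImage f w ≡ true → ∃[ x ] f x ≡ w
inImage-elim f {w} in≡ with fibre f w in e
... | suc _ = let x , fx≡w = count>0 (λ x → f x == w) (subst (0 <_) (sym e) (s≤s z≤n)) in x , ==-sound fx≡w

preimageSize≡fibre : ∀ {k m} (v : Vec (Fin m) k) w → preimageSize v w ≡ fibre (lookup v) w
preimageSize≡fibre v w = length-filter-tabulate (λ u → lookup v u ≟ᶠ w) id

sum-map-homType : ∀ {k m} (h : ℕ → ℕ) → h 0 ≡ 0 → (v : Vec (Fin m) k) →
                  sum (map h (homType v)) ≡ ∑[ w < m ] h (fibre (lookup v) w)
sum-map-homType {m = m} h h0≡0 v = begin
    sum (map h (homType v))
  ≡⟨ sum-↭ (map⁺ h (sortDesc-↭ (filterᵇ nonzero sizes))) ⟩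
    sum (map h (filterᵇ nonzero sizes))
  ≡⟨ sum-map-filter-nonzero h h0≡0 sizes ⟩
    sum (map h sizes)
  ≡⟨ cong sum (sym (map-∘ (allFin m))) ⟩
    sum (map (h ∘ preimageSize v) (allFin m))
  ≡⟨ sum-map-tabulate (h ∘ preimageSize v) id ⟩
    ∑[ w < m ] h (preimageSize v w)
  ≡⟨ sum-cong-≗ (λ w → cong h (preimageSize≡fibre v w)) ⟩
    ∑[ w < m ] h (fibre (lookup v) w)
  ∎
  where
  open ≡-Reasoning
  sizes : List ℕ
  sizes = map (preimageSize v) (allFin m)

sum-homType : ∀ {k m} (v : Vec (Fin m) k) → sum (homType v) ≡ k
sum-homType v = trans (cong sum (sym (map-id (homType v)))) (trans (sum-map-homType id refl v) (∑-fibre (lookup v)))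

length-homType : ∀ {k m} (v : Vec (Fin m) k) → length (homType v) ≡ imageSize (lookup v)
length-homType {m = m} v = begin
    length (homType v)
  ≡⟨ ↭-length (sortDesc-↭ (filterᵇ nonzero (map (preimageSize v) (allFin m)))) ⟩
    length (filterᵇ nonzero (map (preimageSize v) (allFin m)))
  ≡⟨ cong (length ∘ filterᵇ nonzero) (map-tabulate id (preimageSize v)) ⟩
    length (filterᵇ nonzero (tabulate (preimageSize v)))
  ≡⟨ length-filter-tabulate (T? ∘ nonzero) (preimageSize v) ⟩
    ∑[ w < m ] ⟦ does (T? (nonzero (preimageSize v w))) ⟧
  ≡⟨ sum-cong-≗ (λ w → cong ⟦_⟧ (trans (does-T? _) (cong nonzero (preimageSize≡fibre v w)))) ⟩
    imageSize (lookup v)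
  ∎
  where
  open ≡-Reasoning
  does-T? : ∀ b → does (T? b) ≡ b
  does-T? true  = refl
  does-T? false = refl

homType-≤ : ∀ {k m} (v : Vec (Fin m) k) → All (_≤ k) (homType v)
homType-≤ {m = m} v =
  All-resp-↭ (↭-sym (sortDesc-↭ _)) (All.filter⁺ (T? ∘ nonzero) (All.map⁺ (All.tabulate⁺ fibre≤)))
  where
  fibre≤ : ∀ w → preimageSize v w ≤ _
  fibre≤ w = subst (_≤ _) (sym (preimageSize≡fibre v w)) (count≤ _)

-- Homomorphisms of connected bipartite graphs

Vertex : Graph → Set
Vertex G = Fin (nV G)

IsHom : (G H : Graph) → (Vertex G → Vertex H) → Set
IsHom G H f = ∀ {u v} → adj G u v ≡ true → adj H (f u) (f v) ≡ true

isHom-sound : ∀ G H (f : Vec (Vertex H) (nV G)) → isHom G H f ≡ true → IsHom G H (lookup f)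
isHom-sound G H f hom≡ {u} {v} u~v = respects (allᶠ-sound (edgeOk u) (row≡ u) v)
  where
  edgeOk : Vertex G → Vertex G → Bool
  edgeOk u v = not (adj G u v) ∨ adj H (lookup f u) (lookup f v)
  row : Vertex G → Bool
  row u = all (edgeOk u) (allFin (nV G))
  row≡ : ∀ u → allᶠ (edgeOk u) ≡ true
  row≡ u = trans (sym (all-tabulate (edgeOk u) id)) (allᶠ-sound row (trans (sym (all-tabulate row id)) hom≡) u)
  respects : edgeOk u v ≡ true → adj H (lookup f u) (lookup f v) ≡ true
  respects ok rewrite u~v = ok

isHom-complete : ∀ G H (f : Vec (Vertex H) (nV G)) → IsHom G H (lookup f) → isHom G H f ≡ true
isHom-complete G H f hom =
  trans (all-tabulate row id) (allᶠ-complete row (λ u → trans (all-tabulate (edgeOk u) id) (allᶠ-complete (edgeOk u) (edgeOk≡ u))))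
  where
  edgeOk : Vertex G → Vertex G → Bool
  edgeOk u v = not (adj G u v) ∨ adj H (lookup f u) (lookup f v)
  row : Vertex G → Bool
  row u = all (edgeOk u) (allFin (nV G))
  edgeOk≡ : ∀ u v → edgeOk u v ≡ true
  edgeOk≡ u v with adj G u v in u~v
  ... | true  = hom u~v
  ... | false = refl

cherry : (G : Graph) → Vertex G → Vertex G → Vertex G → Bool
cherry G v u w = adj G v u ∧ adj G v w ∧ not (u == w)

-- Paths u – v – w counted with ordered ends, i.e. Σ_v deg v (deg v − 1).
cherries : Graph → ℕ
cherries G = ∑[ v < nV G ] ∑[ u < nV G ] ∑[ w < nV G ] ⟦ cherry G v u w ⟧

selfHomsOfImageSize : Graph → ℕ → ℕ
selfHomsOfImageSize G k = sumMaps (λ f → ⟦ isHom G G f ∧ (imageSize (lookup f) ≡ᵇ k) ⟧)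

-- Connectivity is witnessed by a spanning tree: every vertex but the root is
-- adjacent to its parent, which has smaller height.
record ConnectedBipartite (G : Graph) : Set where
  field
    adj-sym       : ∀ u v → adj G u v ≡ adj G v u
    colour        : Vertex G → Bool
    colour-adj    : ∀ {u v} → adj G u v ≡ true → colour u ≡ not (colour v)
    root child    : Vertex G
    root~child    : adj G root child ≡ true
    parent        : Vertex G → Vertex G
    height        : Vertex G → ℕ
    parent~       : ∀ v → v ≢ root → adj G (parent v) v ≡ true
    height-parent : ∀ v → v ≢ root → height (parent v) < height v

module _ {G : Graph} (B : ConnectedBipartite G) where
  open ConnectedBipartite B

  private
    V : Set
    V = Vertex G
    _~_ : V → V → Set
    u ~ v = adj G u v ≡ true

  ~-sym : ∀ {u v} → u ~ v → v ~ u
  ~-sym {u} {v} u~v = trans (adj-sym v u) u~v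

  ~⇒≢ : ∀ {u v} → u ~ v → u ≢ v
  ~⇒≢ u~v refl = not-¬ refl (colour-adj u~v)

  triangle-free : ∀ {u v w} → u ~ v → v ~ w → u ~ w → ⊥
  triangle-free {u} {v} {w} u~v v~w u~w = not-¬ (begin
      colour u             ≡⟨ colour-adj u~v ⟩
      not (colour v)       ≡⟨ cong not (colour-adj v~w) ⟩
      not (not (colour w)) ≡⟨ not-involutive (colour w) ⟩
      colour w             ∎) (colour-adj u~w)
    where open ≡-Reasoning

  neighbour : ∀ x → ∃[ y ] x ~ y
  neighbour x with x ≟ᶠ root
  ... | yes refl = child , root~child
  ... | no  x≢r  = parent x , ~-sym (parent~ x x≢r)

  xor-colour-constant : (s : V → Bool) → (∀ {u v} → u ~ v → s u ≡ not (s v)) →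
                        ∀ x → s x xor colour x ≡ s root xor colour root
  xor-colour-constant s flips x = go (suc (height x)) x ≤-refl
    where
    go : ∀ h x → height x < h → s x xor colour x ≡ s root xor colour root
    go (suc h) x hx<h with x ≟ᶠ root
    ... | yes refl = refl
    ... | no  x≢r  = begin
        s x xor colour x              ≡⟨ sym (xor-annihilates-not (s x) (colour x)) ⟩
        not (s x) xor not (colour x)  ≡⟨ sym (cong₂ _xor_ (flips p~x) (colour-adj p~x)) ⟩
        s p xor colour p              ≡⟨ go h p (≤-trans (height-parent x x≢r) (≤-pred hx<h)) ⟩
        s root xor colour root        ∎
      where
      open ≡-Reasoning
      p : V
      p = parent x
      p~x : p ~ x
      p~x = parent~ x x≢r

  member : Bool → V
  member c = if colour root xor c then child else root

  member-colour : ∀ c → colour (member c) ≡ c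
  member-colour c with colour root in e | c
  ... | false | false = e
  ... | true  | true  = e
  ... | false | true  = trans (colour-adj (~-sym root~child)) (cong not e)
  ... | true  | false = trans (colour-adj (~-sym root~child)) (cong not e)

  member-xor : ∀ c → colour (member c) xor c ≡ false
  member-xor c = trans (cong (_xor c) (member-colour c)) (xor-same c)

  member-not-xor : ∀ c → colour (member (not c)) xor c ≡ true
  member-not-xor c = trans (cong (_xor c) (member-colour (not c))) (xor-inverseˡ c)

  ∑-fibre-imageSize≡2 : (f : V → V) → IsHom G G f → imageSize f ≡ 2 → (h : ℕ → ℕ) → h 0 ≡ 0 →
                        ∑[ w < nV G ] h (fibre f w) ≡ h (count colour) + h (count (not ∘ colour))
  ∑-fibre-imageSize≡2 f hom im≡2 h h0≡0 = begin
      ∑[ w < nV G ] h (fibre f w)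
    ≡⟨ ∑-two-support (h ∘ fibre f) p≢q outside ⟩
      h (fibre f p) + h (fibre f q)
    ≡⟨ cong₂ (λ x y → h x + h y) (sum-cong-≗ (cong ⟦_⟧ ∘ side-p)) (sum-cong-≗ (cong ⟦_⟧ ∘ side-q)) ⟩
      h (count (λ x → not (colour root) xor colour x)) + h (count (λ x → colour root xor colour x))
    ≡⟨ by-root-colour (colour root) ⟩
      h (count colour) + h (count (not ∘ colour))
    ∎
    where
    open ≡-Reasoning
    p q : V
    p = f root
    q = f child
    p≢q : p ≢ q
    p≢q = ~⇒≢ (hom root~child)
    image≗ : ∀ z → inImage f z ≡ (z == p ∨ z == q)
    image≗ = count≡2-≗ (inImage f) im≡2 (inImage-intro f root) (inImage-intro f child) p≢q
    value : ∀ x → f x ≡ p ⊎ f x ≡ q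
    value x = ==-∨-sound (trans (sym (image≗ (f x))) (inImage-intro f x))
    outside : ∀ w → w ≢ p → w ≢ q → h (fibre f w) ≡ 0
    outside w w≢p w≢q = trans (cong h (inImage≡false f (trans (image≗ w) (cong₂ _∨_ (==-false w≢p) (==-false w≢q))))) h0≡0
    side-p : ∀ x → (f x == p) ≡ not (colour root) xor colour x
    side-p x = xor-solveˡ (trans (xor-colour-constant (λ y → f y == p) (λ u~v → two-valued p≢q (value _) (value _) (~⇒≢ (hom u~v))) x)
                                 (cong (_xor colour root) (==-refl p)))
    side-q : ∀ x → (f x == q) ≡ colour root xor colour x
    side-q x = begin
      f x == q                                ≡⟨ ==-other p≢q (value x) ⟩
      not (f x == p)                          ≡⟨ cong not (side-p x) ⟩
      not (not (colour root) xor colour x)    ≡⟨ not-distribˡ-xor (not (colour root)) (colour x) ⟩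
      not (not (colour root)) xor colour x    ≡⟨ cong (_xor colour x) (not-involutive (colour root)) ⟩
      colour root xor colour x                ∎
    by-root-colour : ∀ r → h (count (λ x → not r xor colour x)) + h (count (λ x → r xor colour x)) ≡
                           h (count colour) + h (count (not ∘ colour))
    by-root-colour false = +-comm (h (count (not ∘ colour))) (h (count colour))
    by-root-colour true  = refl

  private
    pick : Bool → V
    pick b = if b then child else root

  twoColouring : V → V
  twoColouring x = pick (colour root xor colour x)

  private

    pick~pick-not : ∀ b → pick (not b) ~ pick b
    pick~pick-not true  = root~child
    pick~pick-not false = ~-sym root~child

    pick-in : ∀ b → (pick b == root ∨ pick b == child) ≡ true
    pick-in true  = trans (cong (child == root ∨_) (==-refl child)) (∨-zeroʳ _)
    pick-in false rewrite ==-refl root = refl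

  twoColouring-hom : IsHom G G twoColouring
  twoColouring-hom {u} {v} u~v = subst (λ b → pick b ~ twoColouring v) (sym side) (pick~pick-not (colour root xor colour v))
    where
    side : colour root xor colour u ≡ not (colour root xor colour v)
    side = trans (cong (colour root xor_) (colour-adj u~v)) (sym (not-distribʳ-xor (colour root) (colour v)))

  imageSize-twoColouring : imageSize twoColouring ≡ 2
  imageSize-twoColouring = begin
      count (inImage twoColouring)              ≡⟨ sum-cong-≗ (cong ⟦_⟧ ∘ image≗) ⟩
      count (λ z → z == root ∨ z == child)      ≡⟨ count-∨-δ (_== child) (==-false (~⇒≢ root~child)) ⟩
      suc (count (_== child))                   ≡⟨ cong suc (∑-δ₁ child) ⟩
      2                                         ∎
    where
    open ≡-Reasoning
    root↦root : twoColouring root ≡ root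
    root↦root rewrite xor-same (colour root) = refl
    child↦child : twoColouring child ≡ child
    child↦child rewrite colour-adj (~-sym root~child) | xor-inverseʳ (colour root) = refl
    hit : ∀ {z} → z ≡ root ⊎ z ≡ child → inImage twoColouring z ≡ true
    hit (inj₁ refl) = subst (λ y → inImage twoColouring y ≡ true) root↦root (inImage-intro twoColouring root)
    hit (inj₂ refl) = subst (λ y → inImage twoColouring y ≡ true) child↦child (inImage-intro twoColouring child)
    image≗ : ∀ z → inImage twoColouring z ≡ (z == root ∨ z == child)
    image≗ z = Bool-ext
      (λ in≡ → let x , x↦z = inImage-elim twoColouring in≡
               in  subst (λ y → (y == root ∨ y == child) ≡ true) x↦z (pick-in (colour root xor colour x)))
      (hit ∘ ==-∨-sound)

  allowed : Bool → V → (V → Bool) → V → V → Bool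
  allowed c v ends x y = if colour x xor c then ends y else y == v

  allowed-cases : ∀ c v ends x y → allowed c v ends x y ≡ true → ends y ≡ true ⊎ y ≡ v
  allowed-cases c v ends x y e with colour x xor c
  ... | true  = inj₁ e
  ... | false = inj₂ (==-sound e)

  allowed-mono : ∀ c v {ends ends′} x y → (ends y ≡ true → ends′ y ≡ true) →
                 allowed c v ends x y ≡ true → allowed c v ends′ x y ≡ true
  allowed-mono c v x y ends⇒ e with colour x xor c
  ... | true  = ends⇒ e
  ... | false = e

  sumMaps-allowed : ∀ c v (ends : V → Bool) →
    sumMaps (λ f → ⟦ allᶠ (λ x → allowed c v ends x (lookup f x)) ⟧) ≡ count ends ^ count (λ x → colour x xor c)
  sumMaps-allowed c v ends = begin
      sumMaps (λ f → ⟦ allᶠ (λ x → allowed c v ends x (lookup f x)) ⟧)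
    ≡⟨ sumMaps-allᶠ (allowed c v ends) ⟩
      ∏ (λ x → count (allowed c v ends x))
    ≡⟨ ∏-cong-≗ (λ x → choices (colour x xor c)) ⟩
      ∏ (λ x → count ends ^ ⟦ colour x xor c ⟧)
    ≡⟨ ∏-^ (count ends) (λ x → ⟦ colour x xor c ⟧) ⟩
      count ends ^ count (λ x → colour x xor c)
    ∎
    where
    open ≡-Reasoning
    choices : ∀ b → count (λ y → if b then ends y else y == v) ≡ count ends ^ ⟦ b ⟧
    choices true  = sym (*-identityʳ (count ends))
    choices false = ∑-δ₁ v

  allAllowed : Bool → V → (V → Bool) → (V → V) → Bool
  allAllowed c v ends f = allᶠ (λ x → allowed c v ends x (f x))

  folds : Bool → V → V → V → (V → V) → Bool
  folds c v u w f = allAllowed c v (λ y → y == u ∨ y == w) f ∧ inImage f u ∧ inImage f w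

  allAllowed-hits-end : ∀ c {v u w} f → allAllowed c v (λ y → y == u ∨ y == w) f ≡ true → (inImage f u ∨ inImage f w) ≡ true
  allAllowed-hits-end c {v} {u} {w} f e =
    hits (==-∨-sound (subst (λ b → (if b then (f x₀ == u ∨ f x₀ == w) else f x₀ == v) ≡ true) (member-not-xor c) (allᶠ-sound _ e x₀)))
    where
    x₀ : V
    x₀ = member (not c)
    hit : ∀ {y} → f x₀ ≡ y → inImage f y ≡ true
    hit fx₀≡y = subst (λ y → inImage f y ≡ true) fx₀≡y (inImage-intro f x₀)
    hits : f x₀ ≡ u ⊎ f x₀ ≡ w → (inImage f u ∨ inImage f w) ≡ true
    hits (inj₁ fx₀≡u) = cong (_∨ inImage f w) (hit fx₀≡u)
    hits (inj₂ fx₀≡w) = trans (cong (inImage f u ∨_) (hit fx₀≡w)) (∨-zeroʳ _)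

  allAllowed-missing-end : ∀ c {v t t′} (ends : V → Bool) (f : V → V) → v ≢ t → t ≢ t′ → (∀ y → ends y ≡ (y == t ∨ y == t′)) →
                           (allAllowed c v ends f ∧ not (inImage f t)) ≡ allAllowed c v (_== t′) f
  allAllowed-missing-end c {v} {t} {t′} ends f v≢t t≢t′ ends≗ = Bool-ext to from
    where
    to : (allAllowed c v ends f ∧ not (inImage f t)) ≡ true → allAllowed c v (_== t′) f ≡ true
    to e = allᶠ-complete _ (λ x → allowed-mono c v {ends} {_== t′} x (f x) (only-t′ x)
                                                (allᶠ-sound (λ x → allowed c v ends x (f x)) all≡ x))
      where
      all≡ : allAllowed c v ends f ≡ true
      all≡ = ∧-conicalˡ _ _ e
      t∉ : inImage f t ≡ false
      t∉ = not≡true (∧-conicalʳ (allAllowed c v ends f) _ e)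
      only-t′ : ∀ x → ends (f x) ≡ true → (f x == t′) ≡ true
      only-t′ x e′ with ==-∨-sound (trans (sym (ends≗ (f x))) e′)
      ... | inj₁ fx≡t  = ⊥-elim (true≢false (trans (sym (subst (λ y → inImage f y ≡ true) fx≡t (inImage-intro f x))) t∉))
      ... | inj₂ fx≡t′ rewrite fx≡t′ = ==-refl t′
    from : allAllowed c v (_== t′) f ≡ true → (allAllowed c v ends f ∧ not (inImage f t)) ≡ true
    from e = cong₂ (λ a b → a ∧ not b)
                   (allᶠ-complete (λ x → allowed c v ends x (f x))
                                  (λ x → allowed-mono c v {_== t′} {ends} x (f x) (widen (f x))
                                                      (allᶠ-sound (λ x → allowed c v (_== t′) x (f x)) e x)))
                   t∉
      where
      widen : ∀ y → (y == t′) ≡ true → ends y ≡ true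
      widen y e′ = trans (ends≗ y) (trans (cong (y == t ∨_) e′) (∨-zeroʳ _))
      t∉ : inImage f t ≡ false
      t∉ with inImage f t in t∈
      ... | false = refl
      ... | true with inImage-elim f t∈
      ...   | x , fx≡t with allowed-cases c v (_== t′) x (f x) (allᶠ-sound _ e x)
      ...     | inj₁ fx==t′ = ⊥-elim (t≢t′ (trans (sym fx≡t) (==-sound fx==t′)))
      ...     | inj₂ fx≡v   = ⊥-elim (v≢t (trans (sym fx≡v) fx≡t))

  allAllowed-split : ∀ c {v u w} → v ≢ u → v ≢ w → u ≢ w → ∀ f →
    ⟦ allAllowed c v (λ y → y == u ∨ y == w) f ⟧ ≡ ⟦ folds c v u w f ⟧ + ⟦ allAllowed c v (_== w) f ⟧ + ⟦ allAllowed c v (_== u) f ⟧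
  allAllowed-split c {v} {u} {w} v≢u v≢w u≢w f = begin
      ⟦ A ⟧
    ≡⟨ ⟦⟧-split-∨ A (inImage f u) (inImage f w) (allAllowed-hits-end c f) ⟩
      ⟦ A ∧ inImage f u ∧ inImage f w ⟧ + ⟦ A ∧ not (inImage f u) ⟧ + ⟦ A ∧ not (inImage f w) ⟧
    ≡⟨ cong₂ (λ x y → ⟦ folds c v u w f ⟧ + ⟦ x ⟧ + ⟦ y ⟧)
             (allAllowed-missing-end c ends f v≢u u≢w (λ _ → refl))
             (allAllowed-missing-end c ends f v≢w (≢-sym u≢w) (λ y → ∨-comm (y == u) (y == w))) ⟩
      ⟦ folds c v u w f ⟧ + ⟦ allAllowed c v (_== w) f ⟧ + ⟦ allAllowed c v (_== u) f ⟧
    ∎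
    where
    open ≡-Reasoning
    ends : V → Bool
    ends y = y == u ∨ y == w
    A : Bool
    A = allAllowed c v ends f

  sumMaps-folds : ∀ c {v u w} → v ≢ u → v ≢ w → u ≢ w →
                  sumMaps (λ f → ⟦ folds c v u w (lookup f) ⟧) ≡ 2 ^ count (λ x → colour x xor c) ∸ 2
  sumMaps-folds c {v} {u} {w} v≢u v≢w u≢w = sym (begin
      2 ^ N ∸ 2
    ≡⟨ cong (λ b → b ^ N ∸ 2) (sym (trans (count-∨-δ (_== w) (==-false u≢w)) (cong suc (∑-δ₁ w)))) ⟩
      count ends ^ N ∸ 2
    ≡⟨ cong (_∸ 2) (sym (sumMaps-allowed c v ends)) ⟩
      sumMaps (λ f → ⟦ allAllowed c v ends (lookup f) ⟧) ∸ 2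
    ≡⟨ cong (_∸ 2) (trans (sumMaps-cong (allAllowed-split c v≢u v≢w u≢w ∘ lookup)) (sumMaps-+₃ (only w) (only u))) ⟩
      S + sumMaps (only w) + sumMaps (only u) ∸ 2
    ≡⟨ cong₂ (λ x y → S + x + y ∸ 2) (one-end w) (one-end u) ⟩
      S + 1 + 1 ∸ 2
    ≡⟨ cong (_∸ 2) (+-assoc S 1 1) ⟩
      S + 2 ∸ 2
    ≡⟨ m+n∸n≡m S 2 ⟩
      S
    ∎)
    where
    open ≡-Reasoning
    N : ℕ
    N = count (λ x → colour x xor c)
    ends : V → Bool
    ends y = y == u ∨ y == w
    S : ℕ
    S = sumMaps (λ f → ⟦ folds c v u w (lookup f) ⟧)
    only : V → Vec V (nV G) → ℕ
    only t f = ⟦ allAllowed c v (_== t) (lookup f) ⟧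
    one-end : ∀ t → sumMaps (only t) ≡ 1
    one-end t = trans (sumMaps-allowed c v (_== t)) (trans (cong (_^ N) (∑-δ₁ t)) (^-zeroˡ N))
    sumMaps-+₃ : ∀ (g h : Vec V (nV G) → ℕ) → sumMaps (λ f → ⟦ folds c v u w (lookup f) ⟧ + g f + h f) ≡ S + sumMaps g + sumMaps h
    sumMaps-+₃ g h = trans (sumMaps-+ (λ f → ⟦ folds c v u w (lookup f) ⟧ + g f) h)
                             (cong (_+ sumMaps h) (sumMaps-+ (λ f → ⟦ folds c v u w (lookup f) ⟧) g))

  record Folding (c : Bool) (v u w : V) (f : V → V) : Set where
    field
      centre : ∀ x → colour x xor c ≡ false → f x ≡ v
      ends   : ∀ x → colour x xor c ≡ true → f x ≡ u ⊎ f x ≡ w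
      hit-u  : inImage f u ≡ true
      hit-w  : inImage f w ≡ true

    off-centre : ∀ x → f x ≢ v → colour x xor c ≡ true
    off-centre x fx≢v with colour x xor c in e
    ... | true  = refl
    ... | false = ⊥-elim (fx≢v (centre x e))

  folds-sound : ∀ c v u w f → folds c v u w f ≡ true → Folding c v u w f
  folds-sound c v u w f e = record
    { centre = λ x e′ → ==-sound (subst (λ b → (if b then _ else f x == v) ≡ true) e′ (allowed-at x))
    ; ends   = λ x e′ → ==-∨-sound (subst (λ b → (if b then (f x == u ∨ f x == w) else _) ≡ true) e′ (allowed-at x))
    ; hit-u  = ∧-conicalˡ (inImage f u) (inImage f w) images
    ; hit-w  = ∧-conicalʳ (inImage f u) (inImage f w) images
    }
    where
    everywhere : Bool
    everywhere = allᶠ (λ x → allowed c v (λ y → y == u ∨ y == w) x (f x))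
    images : inImage f u ∧ inImage f w ≡ true
    images = ∧-conicalʳ everywhere _ e
    allowed-at : ∀ x → allowed c v (λ y → y == u ∨ y == w) x (f x) ≡ true
    allowed-at = allᶠ-sound _ (∧-conicalˡ everywhere _ e)

  folds-complete : ∀ {c v u w f} → Folding c v u w f → folds c v u w f ≡ true
  folds-complete {c} {v} {u} {w} {f} F =
    cong₂ _∧_ (allᶠ-complete (λ x → allowed c v (λ y → y == u ∨ y == w) x (f x)) allowed-at) (cong₂ _∧_ hit-u hit-w)
    where
    open Folding F
    allowed-at : ∀ x → allowed c v (λ y → y == u ∨ y == w) x (f x) ≡ true
    allowed-at x with colour x xor c in e
    ... | false rewrite centre x e = ==-refl v
    ... | true  with ends x e
    ...   | inj₁ fx≡u rewrite fx≡u | ==-refl u = refl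
    ...   | inj₂ fx≡w rewrite fx≡w | ==-refl w = ∨-zeroʳ _

  xor-colour-adj : ∀ c {x y} → x ~ y → colour y xor c ≡ not (colour x xor c)
  xor-colour-adj c {x} {y} x~y = trans (cong (_xor c) (colour-adj (~-sym x~y))) (sym (not-distribˡ-xor (colour x) c))

  ~-either : ∀ {v u w z} → v ~ u → v ~ w → z ≡ u ⊎ z ≡ w → v ~ z
  ~-either v~u v~w (inj₁ refl) = v~u
  ~-either v~u v~w (inj₂ refl) = v~w

  Folding-hom : ∀ {c v u w f} → Folding c v u w f → v ~ u → v ~ w → IsHom G G f
  Folding-hom {c} F v~u v~w {x} {y} x~y with colour x xor c in ex
  ... | false = subst (_~ _) (sym (Folding.centre F x ex))
                      (~-either v~u v~w (Folding.ends F y (trans (xor-colour-adj c x~y) (cong not ex))))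
  ... | true  = subst (_ ~_) (sym (Folding.centre F y (trans (xor-colour-adj c x~y) (cong not ex))))
                      (~-sym (~-either v~u v~w (Folding.ends F x ex)))

  Folding-image : ∀ {c v u w f} → Folding c v u w f → v ~ u → v ~ w → ∀ z → inImage f z ≡ (z == v ∨ z == u ∨ z == w)
  Folding-image {c} {v} {u} {w} {f} F v~u v~w z = Bool-ext to from
    where
    open Folding F
    to : inImage f z ≡ true → (z == v ∨ z == u ∨ z == w) ≡ true
    to z∈ with inImage-elim f z∈
    ... | x , refl with colour x xor c in e
    ...   | false rewrite centre x e | ==-refl v = refl
    ...   | true  = trans (cong (f x == v ∨_) (==-∨-complete (ends x e))) (∨-zeroʳ _)
    hit : ∀ {y} → y ≡ v ⊎ y ≡ u ⊎ y ≡ w → inImage f y ≡ true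
    hit (inj₁ refl) = subst (λ y → inImage f y ≡ true) (centre (member c) (member-xor c)) (inImage-intro f (member c))
    hit (inj₂ (inj₁ refl)) = hit-u
    hit (inj₂ (inj₂ refl)) = hit-w
    from : (z == v ∨ z == u ∨ z == w) ≡ true → inImage f z ≡ true
    from e with z == v in ev
    ... | true  = hit (inj₁ (==-sound ev))
    ... | false = hit (inj₂ (==-∨-sound e))

  Folding-imageSize : ∀ {c v u w f} → Folding c v u w f → v ~ u → v ~ w → u ≢ w → imageSize f ≡ 3
  Folding-imageSize F v~u v~w u≢w =
    trans (sum-cong-≗ (cong ⟦_⟧ ∘ Folding-image F v~u v~w)) (count-three (~⇒≢ v~u) (~⇒≢ v~w) u≢w)

  -- f x == v flips along every edge (the ends are not adjacent), so it is a function of the colour of x.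
  image⊆cherry⇒Folding : ∀ {v u w} (f : V → V) → IsHom G G f → (∀ x → f x ≡ v ⊎ f x ≡ u ⊎ f x ≡ w) →
                        v ~ u → v ~ w → u ≢ w → inImage f u ≡ true → inImage f w ≡ true → ∃[ c ] Folding c v u w f
  image⊆cherry⇒Folding {v} {u} {w} f hom value v~u v~w u≢w u∈ w∈ = c , record
    { centre = λ x e → ==-sound (trans (side x) (cong not e))
    ; ends   = λ x e → off-v x (==-false⇒≢ (trans (side x) (cong not e)))
    ; hit-u  = u∈
    ; hit-w  = w∈
    }
    where
    ends-not-adjacent : ∀ {a b} → a ≡ u ⊎ a ≡ w → b ≡ u ⊎ b ≡ w → a ~ b → ⊥
    ends-not-adjacent (inj₁ refl) (inj₁ refl) a~b = ~⇒≢ a~b refl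
    ends-not-adjacent (inj₂ refl) (inj₂ refl) a~b = ~⇒≢ a~b refl
    ends-not-adjacent (inj₁ refl) (inj₂ refl) u~w = triangle-free (~-sym v~u) v~w u~w
    ends-not-adjacent (inj₂ refl) (inj₁ refl) w~u = triangle-free (~-sym v~u) v~w (~-sym w~u)
    off-v : ∀ x → f x ≢ v → f x ≡ u ⊎ f x ≡ w
    off-v x fx≢v with value x
    ... | inj₁ fx≡v = ⊥-elim (fx≢v fx≡v)
    ... | inj₂ fx∈  = fx∈
    flips : ∀ {x y} → x ~ y → (f x == v) ≡ not (f y == v)
    flips {x} {y} x~y with f x ≟ᶠ v | f y ≟ᶠ v
    ... | yes fx≡v | yes fy≡v = ⊥-elim (~⇒≢ (hom x~y) (trans fx≡v (sym fy≡v)))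
    ... | yes _    | no  _    = refl
    ... | no  _    | yes _    = refl
    ... | no  fx≢v | no  fy≢v = ⊥-elim (ends-not-adjacent (off-v x fx≢v) (off-v y fy≢v) (hom x~y))
    k c : Bool
    k = (f root == v) xor colour root
    c = not k
    side : ∀ x → (f x == v) ≡ not (colour x xor c)
    side x = trans (xor-solveˡ (xor-colour-constant (λ y → f y == v) flips x)) (xor-not-xor k (colour x))

  record CherryFolding (f : V → V) : Set where
    field
      colourClass      : Bool
      middle end₁ end₂ : V
      middle~end₁      : middle ~ end₁
      middle~end₂      : middle ~ end₂
      end₁≢end₂        : end₁ ≢ end₂
      folding          : Folding colourClass middle end₁ end₂ f

  private
    mkCherryFolding : ∀ {v u w} f → IsHom G G f → (∀ z → f z ≡ v ⊎ f z ≡ u ⊎ f z ≡ w) → v ~ u → v ~ w → u ≢ w →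
                      inImage f u ≡ true → inImage f w ≡ true → CherryFolding f
    mkCherryFolding f hom value v~u v~w u≢w u∈ w∈ =
      let c , F = image⊆cherry⇒Folding f hom value v~u v~w u≢w u∈ w∈
      in  record { colourClass = c ; middle~end₁ = v~u ; middle~end₂ = v~w ; end₁≢end₂ = u≢w ; folding = F }

    CherryFolding-from-third-point : ∀ f → IsHom G G f → ∀ {r} → r ≢ f root → r ≢ f child → inImage f r ≡ true →
                                     (∀ z → f z ≡ f root ⊎ f z ≡ f child ⊎ f z ≡ r) → CherryFolding f
    CherryFolding-from-third-point f hom r≢p r≢q r∈ value with inImage-elim f r∈
    ... | x , refl with neighbour x
    ... | y , x~y with value y
    ... | inj₂ (inj₂ fy≡fx) = ⊥-elim (~⇒≢ (hom x~y) (sym fy≡fx))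
    ... | inj₁ fy≡p =
      mkCherryFolding f hom value (hom root~child) (subst (_~ f x) fy≡p (~-sym (hom x~y))) (≢-sym r≢q)
                      (inImage-intro f child) r∈
    ... | inj₂ (inj₁ fy≡q) =
      mkCherryFolding f hom value′ (~-sym (hom root~child)) (subst (_~ f x) fy≡q (~-sym (hom x~y))) (≢-sym r≢p)
                      (inImage-intro f root) r∈
      where
      value′ : ∀ z → f z ≡ f child ⊎ f z ≡ f root ⊎ f z ≡ f x
      value′ z with value z
      ... | inj₁ e        = inj₂ (inj₁ e)
      ... | inj₂ (inj₁ e) = inj₁ e
      ... | inj₂ (inj₂ e) = inj₂ (inj₂ e)

  -- The third image point has a neighbour in the image, necessarily f root or f child,
  -- and that neighbour is the middle of the cherry.
  imageSize≡3⇒CherryFolding : ∀ f → IsHom G G f → imageSize f ≡ 3 → CherryFolding f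
  imageSize≡3⇒CherryFolding f hom im≡3 with count≡3-≗ (inImage f) im≡3 (inImage-intro f root) (inImage-intro f child) (~⇒≢ (hom root~child))
  ... | r , r≢p , r≢q , r∈ , image≗ =
    CherryFolding-from-third-point f hom r≢p r≢q r∈ (λ z → ==-∨-sound₃ (trans (sym (image≗ (f z))) (inImage-intro f z)))

  Folding-swap : ∀ {c v u w f} → Folding c v u w f → Folding c v w u f
  Folding-swap F = record
    { centre = centre
    ; ends   = λ x e → ⊎-swap (ends x e)
    ; hit-u  = hit-w
    ; hit-w  = hit-u
    }
    where
    open Folding F

  Folding-exclusive : ∀ {v u w f} → Folding false v u w f → Folding true v u w f → v ~ u → v ~ w → ⊥
  Folding-exclusive {v} {u} {w} {f} F₀ F₁ v~u v~w = centre-is-end (Folding.ends F₁ x₀ (member-not-xor true))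
    where
    x₀ : V
    x₀ = member false
    fx₀≡v : f x₀ ≡ v
    fx₀≡v = Folding.centre F₀ x₀ (member-xor false)
    centre-is-end : f x₀ ≡ u ⊎ f x₀ ≡ w → ⊥
    centre-is-end (inj₁ fx₀≡u) = ~⇒≢ v~u (trans (sym fx₀≡v) fx₀≡u)
    centre-is-end (inj₂ fx₀≡w) = ~⇒≢ v~w (trans (sym fx₀≡v) fx₀≡w)

  Folding-unique : ∀ {f} (W : CherryFolding f) {c v u w} → Folding c v u w f → v ~ u → v ~ w → u ≢ w →
                   v ≡ CherryFolding.middle W ×
                   (u ≡ CherryFolding.end₁ W × w ≡ CherryFolding.end₂ W ⊎ u ≡ CherryFolding.end₂ W × w ≡ CherryFolding.end₁ W)
  Folding-unique {f} W {c} {v} {u} {w} F v~u v~w u≢w = by-class (c Bool.≟ colourClass)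
    where
    open CherryFolding W
    module F = Folding F
    module F₀ = Folding folding
    end-preimage : ∀ {z} → v ~ z → inImage f z ≡ true → ∃[ x ] f x ≡ z × colour x xor c ≡ true
    end-preimage v~z z∈ with inImage-elim f z∈
    ... | x , refl = x , refl , F.off-centre x (≢-sym (~⇒≢ v~z))
    by-class : Dec (c ≡ colourClass) → _
    by-class (no c≢c₀) = ⊥-elim (u≢w (trans (into-middle v~u F.hit-u) (sym (into-middle v~w F.hit-w))))
      where
      into-middle : ∀ {z} → v ~ z → inImage f z ≡ true → z ≡ middle
      into-middle v~z z∈ with end-preimage v~z z∈
      ... | x , refl , end = F₀.centre x (xor-flip {colour x} c≢c₀ end)
    by-class (yes c≡c₀) = v≡m , ends-match (into-ends v~u F.hit-u) (into-ends v~w F.hit-w)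
      where
      x₀ : V
      x₀ = member c
      v≡m : v ≡ middle
      v≡m = trans (sym (F.centre x₀ (member-xor c))) (F₀.centre x₀ (subst (λ c′ → colour x₀ xor c′ ≡ false) c≡c₀ (member-xor c)))
      into-ends : ∀ {z} → v ~ z → inImage f z ≡ true → z ≡ end₁ ⊎ z ≡ end₂
      into-ends v~z z∈ with end-preimage v~z z∈
      ... | x , refl , end = F₀.ends x (subst (λ c′ → colour x xor c′ ≡ true) c≡c₀ end)
      ends-match : u ≡ end₁ ⊎ u ≡ end₂ → w ≡ end₁ ⊎ w ≡ end₂ → u ≡ end₁ × w ≡ end₂ ⊎ u ≡ end₂ × w ≡ end₁
      ends-match (inj₁ u≡e₁) (inj₂ w≡e₂) = inj₁ (u≡e₁ , w≡e₂)
      ends-match (inj₂ u≡e₂) (inj₁ w≡e₁) = inj₂ (u≡e₂ , w≡e₁)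
      ends-match (inj₁ u≡e₁) (inj₁ w≡e₁) = ⊥-elim (u≢w (trans u≡e₁ (sym w≡e₁)))
      ends-match (inj₂ u≡e₂) (inj₂ w≡e₂) = ⊥-elim (u≢w (trans u≡e₂ (sym w≡e₂)))

  cherry-sound : ∀ {v u w} → cherry G v u w ≡ true → v ~ u × v ~ w × u ≢ w
  cherry-sound {v} {u} {w} e = ∧-conicalˡ _ _ e , ∧-conicalˡ _ _ rest , ==-false⇒≢ (not≡true (∧-conicalʳ (adj G v w) _ rest))
    where rest = ∧-conicalʳ (adj G v u) (adj G v w ∧ not (u == w)) e

  cherry-complete : ∀ {v u w} → v ~ u → v ~ w → u ≢ w → cherry G v u w ≡ true
  cherry-complete v~u v~w u≢w rewrite v~u | v~w | ==-false u≢w = refl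

  foldsEither : V → V → V → (V → V) → Bool
  foldsEither v u w f = folds false v u w f ∨ folds true v u w f

  foldsOntoCherry : V → V → V → (V → V) → Bool
  foldsOntoCherry v u w f = cherry G v u w ∧ foldsEither v u w f

  foldsOntoCherry-sound : ∀ {v u w f} → foldsOntoCherry v u w f ≡ true → ∃[ c ] Folding c v u w f × v ~ u × v ~ w × u ≢ w
  foldsOntoCherry-sound {v} {u} {w} {f} e with folds false v u w f in e₀
  ... | true  = false , folds-sound false v u w f e₀ , cherry-sound (∧-conicalˡ _ _ e)
  ... | false = true  , folds-sound true v u w f (∧-conicalʳ (cherry G v u w) _ e) , cherry-sound (∧-conicalˡ _ _ e)

  foldsOntoCherry-complete : ∀ {c v u w f} → Folding c v u w f → v ~ u → v ~ w → u ≢ w → foldsOntoCherry v u w f ≡ true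
  foldsOntoCherry-complete {false} F v~u v~w u≢w rewrite cherry-complete v~u v~w u≢w | folds-complete F = refl
  foldsOntoCherry-complete {true}  F v~u v~w u≢w rewrite cherry-complete v~u v~w u≢w | folds-complete F = ∨-zeroʳ _

  -- Each cherry receives 2 ^ s ∸ 2 foldings for either choice of the colour class sent to its middle,
  -- s being the size of the other class.
  foldings : ℕ
  foldings = (2 ^ count colour ∸ 2) + (2 ^ count (not ∘ colour) ∸ 2)

  sumMaps-foldsEither : ∀ {v u w} → v ~ u → v ~ w → u ≢ w → sumMaps (λ f → ⟦ foldsEither v u w (lookup f) ⟧) ≡ foldings
  sumMaps-foldsEither {v} {u} {w} v~u v~w u≢w = begin
      sumMaps (λ f → ⟦ foldsEither v u w (lookup f) ⟧)
    ≡⟨ sumMaps-cong (λ f → ⟦⟧-∨ _ _ (exclusive (lookup f))) ⟩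
      sumMaps (λ f → ⟦ folds false v u w (lookup f) ⟧ + ⟦ folds true v u w (lookup f) ⟧)
    ≡⟨ sumMaps-+ (λ f → ⟦ folds false v u w (lookup f) ⟧) (λ f → ⟦ folds true v u w (lookup f) ⟧) ⟩
      sumMaps (λ f → ⟦ folds false v u w (lookup f) ⟧) + sumMaps (λ f → ⟦ folds true v u w (lookup f) ⟧)
    ≡⟨ cong₂ _+_ (sumMaps-folds false (~⇒≢ v~u) (~⇒≢ v~w) u≢w) (sumMaps-folds true (~⇒≢ v~u) (~⇒≢ v~w) u≢w) ⟩
      (2 ^ count (λ x → colour x xor false) ∸ 2) + (2 ^ count (λ x → colour x xor true) ∸ 2)
    ≡⟨ cong₂ (λ a b → (2 ^ a ∸ 2) + (2 ^ b ∸ 2)) (sum-cong-≗ (cong ⟦_⟧ ∘ xor-identityʳ ∘ colour))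
                                                  (sum-cong-≗ (λ x → cong ⟦_⟧ (xor-comm (colour x) true))) ⟩
      foldings
    ∎
    where
    open ≡-Reasoning
    exclusive : ∀ f → folds false v u w f ≡ true → folds true v u w f ≡ false
    exclusive f e₀ with folds true v u w f in e₁
    ... | false = refl
    ... | true  = ⊥-elim (Folding-exclusive (folds-sound false v u w f e₀) (folds-sound true v u w f e₁) v~u v~w)

  sumMaps-foldsOntoCherry : ∀ v u w → sumMaps (λ f → ⟦ foldsOntoCherry v u w (lookup f) ⟧) ≡ ⟦ cherry G v u w ⟧ * foldings
  sumMaps-foldsOntoCherry v u w =
    trans (sumMaps-cong (λ f → ⟦⟧-∧ (cherry G v u w) (foldsEither v u w (lookup f))))
          (trans (sumMaps-*ˡ ⟦ cherry G v u w ⟧ (λ f → ⟦ foldsEither v u w (lookup f) ⟧)) (by-cherry (cherry G v u w) refl))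
    where
    by-cherry : ∀ b → cherry G v u w ≡ b → ⟦ b ⟧ * sumMaps (λ f → ⟦ foldsEither v u w (lookup f) ⟧) ≡ ⟦ b ⟧ * foldings
    by-cherry false _ = refl
    by-cherry true  e = let v~u , v~w , u≢w = cherry-sound e in cong (1 *_) (sumMaps-foldsEither v~u v~w u≢w)

  ∑-foldsOntoCherry≡2 : ∀ {f} → CherryFolding f →
    ∑[ v < nV G ] ∑[ u < nV G ] ∑[ w < nV G ] ⟦ foldsOntoCherry v u w f ⟧ ≡ 2
  ∑-foldsOntoCherry≡2 {f} W = begin
      ∑[ v < n ] ∑[ u < n ] ∑[ w < n ] ⟦ foldsOntoCherry v u w f ⟧
    ≡⟨ sum-cong-≗ (λ v → sum-cong-≗ (λ u → sum-cong-≗ (λ w → cong ⟦_⟧ (unique v u w)))) ⟩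
      ∑[ v < n ] ∑[ u < n ] ∑[ w < n ] ⟦ v == middle ∧ orderedPair end₁ end₂ u w ⟧
    ≡⟨ sum-cong-≗ (λ v → trans (sum-cong-≗ (λ u → trans (sum-cong-≗ (λ w → ⟦⟧-∧ (v == middle) (pair u w)))
                                                        (∑-*ˡ ⟦ v == middle ⟧ (λ w → ⟦ pair u w ⟧))))
                                (∑-*ˡ ⟦ v == middle ⟧ (λ u → ∑[ w < n ] ⟦ pair u w ⟧))) ⟩
      ∑[ v < n ] (⟦ v == middle ⟧ * ∑[ u < n ] ∑[ w < n ] ⟦ pair u w ⟧)
    ≡⟨ ∑-δ middle (λ _ → ∑[ u < n ] ∑[ w < n ] ⟦ pair u w ⟧) ⟩
      ∑[ u < n ] ∑[ w < n ] ⟦ pair u w ⟧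
    ≡⟨ ∑-orderedPair end₁≢end₂ ⟩
      2
    ∎
    where
    open ≡-Reasoning
    open CherryFolding W
    n : ℕ
    n = nV G
    pair : V → V → Bool
    pair = orderedPair end₁ end₂
    unique : ∀ v u w → foldsOntoCherry v u w f ≡ (v == middle ∧ pair u w)
    unique v u w = Bool-ext to from
      where
      to : foldsOntoCherry v u w f ≡ true → (v == middle ∧ pair u w) ≡ true
      to q with foldsOntoCherry-sound q
      ... | c , F , v~u , v~w , u≢w with Folding-unique W F v~u v~w u≢w
      ...   | refl , ends = cong₂ _∧_ (==-refl middle) (orderedPair-complete ends)
      from : (v == middle ∧ pair u w) ≡ true → foldsOntoCherry v u w f ≡ true
      from q with ==-sound {a = v} {b = middle} (∧-conicalˡ (v == middle) (pair u w) q)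
                | orderedPair-sound {a = end₁} {b = end₂} {u = u} {w = w} (∧-conicalʳ (v == middle) (pair u w) q)
      ... | refl | inj₁ (refl , refl) = foldsOntoCherry-complete folding middle~end₁ middle~end₂ end₁≢end₂
      ... | refl | inj₂ (refl , refl) =
        foldsOntoCherry-complete (Folding-swap folding) middle~end₂ middle~end₁ (≢-sym end₁≢end₂)

  ∑-foldsOntoCherry : (f : Vec V (nV G)) →
    ∑[ v < nV G ] ∑[ u < nV G ] ∑[ w < nV G ] ⟦ foldsOntoCherry v u w (lookup f) ⟧ ≡
    2 * ⟦ isHom G G f ∧ (imageSize (lookup f) ≡ᵇ 3) ⟧
  ∑-foldsOntoCherry f with isHom G G f ∧ (imageSize (lookup f) ≡ᵇ 3) in e
  ... | true  = ∑-foldsOntoCherry≡2 (imageSize≡3⇒CherryFolding (lookup f) hom im≡3)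
    where
    hom : IsHom G G (lookup f)
    hom = isHom-sound G G f (∧-conicalˡ (isHom G G f) (imageSize (lookup f) ≡ᵇ 3) e)
    im≡3 : imageSize (lookup f) ≡ 3
    im≡3 = ≡ᵇ⇒≡ (imageSize (lookup f)) 3 (subst T (sym (∧-conicalʳ (isHom G G f) (imageSize (lookup f) ≡ᵇ 3) e)) tt)
  ... | false = ∑-zero _ (λ v → ∑-zero _ (λ u → ∑-zero _ (λ w → cong ⟦_⟧ (none v u w))))
    where
    none : ∀ v u w → foldsOntoCherry v u w (lookup f) ≡ false
    none v u w with foldsOntoCherry v u w (lookup f) in q
    ... | false = refl
    ... | true with foldsOntoCherry-sound q
    ...   | c , F , v~u , v~w , u≢w = ⊥-elim (true≢false (trans (sym is-three) e))
      where
      is-three : isHom G G f ∧ (imageSize (lookup f) ≡ᵇ 3) ≡ true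
      is-three rewrite isHom-complete G G f (Folding-hom F v~u v~w) | Folding-imageSize F v~u v~w u≢w = refl

  -- A self-homomorphism with a 3-point image folds G onto exactly one cherry, which is counted
  -- twice since its ends can be swapped.
  2*selfHoms₃≡cherries*foldings : 2 * selfHomsOfImageSize G 3 ≡ cherries G * foldings
  2*selfHoms₃≡cherries*foldings = begin
      2 * sumMaps three
    ≡⟨ sym (sumMaps-*ˡ 2 three) ⟩
      sumMaps (λ f → 2 * three f)
    ≡⟨ sumMaps-cong (λ f → sym (∑-foldsOntoCherry f)) ⟩
      sumMaps (λ f → ∑[ v < n ] ∑[ u < n ] ∑[ w < n ] term v u w f)
    ≡⟨ sumMaps-∑ (λ f v → ∑[ u < n ] ∑[ w < n ] term v u w f) ⟩
      ∑[ v < n ] sumMaps (λ f → ∑[ u < n ] ∑[ w < n ] term v u w f)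
    ≡⟨ sum-cong-≗ (λ v → trans (sumMaps-∑ (λ f u → ∑[ w < n ] term v u w f))
                               (sum-cong-≗ (λ u → sumMaps-∑ (λ f w → term v u w f)))) ⟩
      ∑[ v < n ] ∑[ u < n ] ∑[ w < n ] sumMaps (term v u w)
    ≡⟨ sum-cong-≗ (λ v → sum-cong-≗ (λ u → sum-cong-≗ (λ w → sumMaps-foldsOntoCherry v u w))) ⟩
      ∑[ v < n ] ∑[ u < n ] ∑[ w < n ] (⟦ cherry G v u w ⟧ * foldings)
    ≡⟨ sum-cong-≗ (λ v → trans (sum-cong-≗ (λ u → ∑-*ʳ foldings (λ w → ⟦ cherry G v u w ⟧)))
                               (∑-*ʳ foldings (λ u → ∑[ w < n ] ⟦ cherry G v u w ⟧))) ⟩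
      ∑[ v < n ] (∑[ u < n ] ∑[ w < n ] ⟦ cherry G v u w ⟧ * foldings)
    ≡⟨ ∑-*ʳ foldings (λ v → ∑[ u < n ] ∑[ w < n ] ⟦ cherry G v u w ⟧) ⟩
      cherries G * foldings
    ∎
    where
    open ≡-Reasoning
    n : ℕ
    n = nV G
    three : Vec V n → ℕ
    three f = ⟦ isHom G G f ∧ (imageSize (lookup f) ≡ᵇ 3) ⟧
    term : V → V → V → Vec V n → ℕ
    term v u w f = ⟦ foldsOntoCherry v u w (lookup f) ⟧

  count-colour+count-not : count colour + count (not ∘ colour) ≡ nV G
  count-colour+count-not = begin
      count colour + count (not ∘ colour)           ≡⟨ sym (∑-distrib-+ (⟦_⟧ ∘ colour) (⟦_⟧ ∘ not ∘ colour)) ⟩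
      ∑[ x < nV G ] (⟦ colour x ⟧ + ⟦ not (colour x) ⟧) ≡⟨ sum-cong-≗ (λ x → trans (+-comm ⟦ colour x ⟧ _) (⟦not⟧+⟦⟧ (colour x))) ⟩
      ∑[ x < nV G ] 1                               ≡⟨ ∑-one (nV G) ⟩
      nV G                                          ∎
    where open ≡-Reasoning

  foldings>0 : 3 ≤ nV G → 0 < foldings
  foldings>0 3≤n = 2^a∸2+2^b∸2>0 blacks>0 whites>0 (subst (3 ≤_) (sym count-colour+count-not) 3≤n)
    where
    blacks>0 : 1 ≤ count colour
    blacks>0 = subst (λ b → ⟦ b ⟧ ≤ count colour) (member-colour true) (term≤∑ (⟦_⟧ ∘ colour) (member true))
    whites>0 : 1 ≤ count (not ∘ colour)
    whites>0 = subst (λ b → ⟦ not b ⟧ ≤ count (not ∘ colour)) (member-colour false) (term≤∑ (⟦_⟧ ∘ not ∘ colour) (member false))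

-- Coefficients of the self-chromatic symmetric function

nCk>0 : ∀ n k → k ≤ n → 0 < n C k
nCk>0 n       zero    _         = s≤s z≤n
nCk>0 (suc n) (suc k) (s≤s k≤n) =
  subst (0 <_) (nCk+nC[k+1]≡[n+1]C[k+1] n k) (≤-trans (nCk>0 n k k≤n) (m≤m+n _ _))

multinomial>0 : ∀ N rs → sum rs ≤ N → 0 < multinomial N rs
multinomial>0 N []       _  = s≤s z≤n
multinomial>0 N (r ∷ rs) r+rs≤N = m*n>0 (nCk>0 N r (≤-trans (m≤m+n r (sum rs)) r+rs≤N))
  (multinomial>0 (N ∸ r) rs (subst (_≤ N ∸ r) (m+n∸m≡n r (sum rs)) (∸-monoˡ-≤ r r+rs≤N)))

sum-map-applyUpTo : ∀ (g f : ℕ → ℕ) s → sum (map g (applyUpTo f s)) ≡ ∑[ i < s ] g (f (toℕ i))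
sum-map-applyUpTo g f zero    = refl
sum-map-applyUpTo g f (suc s) = cong (g (f 0) +_) (sum-map-applyUpTo g (f ∘ suc) s)

mult-∷ : ∀ k ν j → mult (k ∷ ν) j ≡ ⟦ k ≡ᵇ j ⟧ + mult ν j
mult-∷ k ν j with k ≡ᵇ j
... | true  = refl
... | false = refl

∑-≡ᵇ-toℕ≤1 : ∀ s x → ∑[ i < s ] ⟦ x ≡ᵇ toℕ i ⟧ ≤ 1
∑-≡ᵇ-toℕ≤1 zero    x       = z≤n
∑-≡ᵇ-toℕ≤1 (suc s) zero    = s≤s (≤-reflexive (∑-zero {s} _ (λ _ → refl)))
∑-≡ᵇ-toℕ≤1 (suc s) (suc x) = ∑-≡ᵇ-toℕ≤1 s x

∑-≡ᵇ-toℕ : ∀ s x → x < s → ∑[ i < s ] ⟦ x ≡ᵇ toℕ i ⟧ ≡ 1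
∑-≡ᵇ-toℕ (suc s) zero    _         = cong suc (∑-zero {s} _ (λ _ → refl))
∑-≡ᵇ-toℕ (suc s) (suc x) (s≤s x<s) = ∑-≡ᵇ-toℕ s x x<s

∑-mult≤length : ∀ s ν → ∑[ i < s ] mult ν (suc (toℕ i)) ≤ length ν
∑-mult≤length s []      = ≤-reflexive (∑-zero {s} _ (λ _ → refl))
∑-mult≤length s (k ∷ ν) = begin
    ∑[ i < s ] mult (k ∷ ν) (suc (toℕ i))
  ≡⟨ sum-cong-≗ {s} (λ i → mult-∷ k ν (suc (toℕ i))) ⟩
    ∑[ i < s ] (⟦ k ≡ᵇ suc (toℕ i) ⟧ + mult ν (suc (toℕ i)))
  ≡⟨ ∑-distrib-+ {s} (λ i → ⟦ k ≡ᵇ suc (toℕ i) ⟧) (λ i → mult ν (suc (toℕ i))) ⟩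
    ∑[ i < s ] ⟦ k ≡ᵇ suc (toℕ i) ⟧ + ∑[ i < s ] mult ν (suc (toℕ i))
  ≤⟨ +-mono-≤ (at-most-one k) (∑-mult≤length s ν) ⟩
    suc (length ν)
  ∎
  where
  open ≤-Reasoning
  at-most-one : ∀ k → ∑[ i < s ] ⟦ k ≡ᵇ suc (toℕ i) ⟧ ≤ 1
  at-most-one zero    = ≤-trans (≤-reflexive (∑-zero {s} _ (λ _ → refl))) z≤n
  at-most-one (suc k) = ∑-≡ᵇ-toℕ≤1 s k

mNcoeff>0 : ∀ N ν → length ν ≤ N → 0 < mNcoeff N ν
mNcoeff>0 N ν ℓ≤N = multinomial>0 N (map (λ i → mult ν (suc i)) (upTo (sum ν))) (begin
    sum (map (λ i → mult ν (suc i)) (upTo (sum ν)))  ≡⟨ sum-map-applyUpTo (λ i → mult ν (suc i)) id (sum ν) ⟩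
    ∑[ i < sum ν ] mult ν (suc (toℕ i))              ≤⟨ ∑-mult≤length (sum ν) ν ⟩
    length ν                                          ≤⟨ ℓ≤N ⟩
    N                                                 ∎)
  where open ≤-Reasoning

listEqᵇ-sound : ∀ xs ys → listEqᵇ xs ys ≡ true → xs ≡ ys
listEqᵇ-sound []       []       _ = refl
listEqᵇ-sound (x ∷ xs) (y ∷ ys) e =
  cong₂ _∷_ (≡ᵇ⇒≡ x y (subst T (sym (∧-conicalˡ _ _ e)) tt)) (listEqᵇ-sound xs ys (∧-conicalʳ (x ≡ᵇ y) _ e))

listEqᵇ-refl : ∀ xs → listEqᵇ xs xs ≡ true
listEqᵇ-refl []       = refl
listEqᵇ-refl (x ∷ xs) = cong₂ _∧_ (≡ᵇ-refl x) (listEqᵇ-refl xs)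

listEqᵇ-length : ∀ xs ys → length xs ≢ length ys → listEqᵇ xs ys ≡ false
listEqᵇ-length []       []       ℓ≢ = ⊥-elim (ℓ≢ refl)
listEqᵇ-length []       (_ ∷ _)  _  = refl
listEqᵇ-length (_ ∷ _)  []       _  = refl
listEqᵇ-length (x ∷ xs) (y ∷ ys) ℓ≢ =
  trans (cong ((x ≡ᵇ y) ∧_) (listEqᵇ-length xs ys (ℓ≢ ∘ cong suc))) (∧-zeroʳ (x ≡ᵇ y))

d≡sumMaps : ∀ G H ν → d G H ν ≡ sumMaps (λ f → ⟦ isHom G H f ⟧ * ⟦ listEqᵇ (homType f) ν ⟧)
d≡sumMaps G H ν =
  trans (length-filterᵇ-maps (nV G) (nV H) _) (sumMaps-cong (λ f → ⟦⟧-∧ (isHom G H f) (listEqᵇ (homType f) ν)))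

∑-product : ∀ {m n} (g : Fin m → ℕ) (h : Fin n → ℕ) → ∑[ i < m ] ∑[ j < n ] (g i * h j) ≡ ∑ g * ∑ h
∑-product {m} g h = trans (sum-cong-≗ {m} (λ i → ∑-*ˡ (g i) h)) (∑-*ʳ (∑ h) g)

∑³-listEqᵇ-length≢3 : ∀ n t → length t ≢ 3 →
  ∑[ a < suc n ] ∑[ b < suc n ] ∑[ c < suc n ] ⟦ listEqᵇ t (toℕ a ∷ toℕ b ∷ toℕ c ∷ []) ⟧ ≡ ⟦ length t ≡ᵇ 3 ⟧
∑³-listEqᵇ-length≢3 n t ℓ≢3 = trans
  (∑-zero {suc n} _ (λ a → ∑-zero {suc n} _ (λ b → ∑-zero {suc n} _ (λ c →
    cong ⟦_⟧ (listEqᵇ-length t (toℕ a ∷ toℕ b ∷ toℕ c ∷ []) ℓ≢3)))))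
  (sym (cong ⟦_⟧ (≡ᵇ-false ℓ≢3)))

∑³-listEqᵇ : ∀ n (t : List ℕ) → All (_≤ n) t →
  ∑[ a < suc n ] ∑[ b < suc n ] ∑[ c < suc n ] ⟦ listEqᵇ t (toℕ a ∷ toℕ b ∷ toℕ c ∷ []) ⟧ ≡ ⟦ length t ≡ᵇ 3 ⟧
∑³-listEqᵇ n t@[]                _ = ∑³-listEqᵇ-length≢3 n t λ ()
∑³-listEqᵇ n t@(_ ∷ [])          _ = ∑³-listEqᵇ-length≢3 n t λ ()
∑³-listEqᵇ n t@(_ ∷ _ ∷ [])      _ = ∑³-listEqᵇ-length≢3 n t λ ()
∑³-listEqᵇ n t@(_ ∷ _ ∷ _ ∷ _ ∷ _) _ = ∑³-listEqᵇ-length≢3 n t λ ()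
∑³-listEqᵇ n (x ∷ y ∷ z ∷ []) (x≤ ∷ y≤ ∷ z≤ ∷ []) = begin
    ∑[ a < suc n ] ∑[ b < suc n ] ∑[ c < suc n ] ⟦ P a ∧ Q b ∧ R c ∧ true ⟧
  ≡⟨ sum-cong-≗ {suc n} (λ a → sum-cong-≗ {suc n} (λ b → sum-cong-≗ {suc n} (λ c → factor (P a) (Q b) (R c)))) ⟩
    ∑[ a < suc n ] ∑[ b < suc n ] ∑[ c < suc n ] (⟦ P a ⟧ * (⟦ Q b ⟧ * ⟦ R c ⟧))
  ≡⟨ sum-cong-≗ {suc n} (λ a → trans (sum-cong-≗ {suc n} (λ b → ∑-*ˡ ⟦ P a ⟧ (λ c → ⟦ Q b ⟧ * ⟦ R c ⟧)))
                                     (∑-*ˡ ⟦ P a ⟧ (λ b → ∑[ c < suc n ] (⟦ Q b ⟧ * ⟦ R c ⟧)))) ⟩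
    ∑[ a < suc n ] (⟦ P a ⟧ * ∑[ b < suc n ] ∑[ c < suc n ] (⟦ Q b ⟧ * ⟦ R c ⟧))
  ≡⟨ trans (∑-*ʳ _ (⟦_⟧ ∘ P)) (cong (∑ (⟦_⟧ ∘ P) *_) (∑-product (⟦_⟧ ∘ Q) (⟦_⟧ ∘ R))) ⟩
    ∑ (⟦_⟧ ∘ P) * (∑ (⟦_⟧ ∘ Q) * ∑ (⟦_⟧ ∘ R))
  ≡⟨ cong₂ _*_ (∑-≡ᵇ-toℕ (suc n) x (s≤s x≤)) (cong₂ _*_ (∑-≡ᵇ-toℕ (suc n) y (s≤s y≤)) (∑-≡ᵇ-toℕ (suc n) z (s≤s z≤))) ⟩
    1
  ∎
  where
  open ≡-Reasoning
  P Q R : Fin (suc n) → Bool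
  P a = x ≡ᵇ toℕ a
  Q b = y ≡ᵇ toℕ b
  R c = z ≡ᵇ toℕ c
  factor : ∀ p q r → ⟦ p ∧ q ∧ r ∧ true ⟧ ≡ ⟦ p ⟧ * (⟦ q ⟧ * ⟦ r ⟧)
  factor p q r rewrite ∧-identityʳ r = trans (⟦⟧-∧ p (q ∧ r)) (cong (⟦ p ⟧ *_) (⟦⟧-∧ q r))

selfHoms₃≡∑d : ∀ G → let n = nV G in
  ∑[ a < suc n ] ∑[ b < suc n ] ∑[ c < suc n ] d G G (toℕ a ∷ toℕ b ∷ toℕ c ∷ []) ≡ selfHomsOfImageSize G 3
selfHoms₃≡∑d G = begin
    ∑[ a < suc n ] ∑[ b < suc n ] ∑[ c < suc n ] d G G (triple a b c)
  ≡⟨ sum-cong-≗ {suc n} (λ a → sum-cong-≗ {suc n} (λ b → sum-cong-≗ {suc n} (λ c → d≡sumMaps G G (triple a b c)))) ⟩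
    ∑[ a < suc n ] ∑[ b < suc n ] ∑[ c < suc n ] sumMaps (λ f → term f a b c)
  ≡⟨ sym (sum-cong-≗ {suc n} (λ a → trans (sumMaps-∑ (λ f b → ∑[ c < suc n ] term f a b c))
                                          (sum-cong-≗ {suc n} (λ b → sumMaps-∑ (λ f c → term f a b c))))) ⟩
    ∑[ a < suc n ] sumMaps (λ f → ∑[ b < suc n ] ∑[ c < suc n ] term f a b c)
  ≡⟨ sym (sumMaps-∑ (λ f a → ∑[ b < suc n ] ∑[ c < suc n ] term f a b c)) ⟩
    sumMaps (λ f → ∑[ a < suc n ] ∑[ b < suc n ] ∑[ c < suc n ] term f a b c)
  ≡⟨ sumMaps-cong (λ f → trans (pull f) (cong (⟦ isHom G G f ⟧ *_) (∑³-listEqᵇ n (homType f) (homType-≤ f)))) ⟩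
    sumMaps (λ f → ⟦ isHom G G f ⟧ * ⟦ length (homType f) ≡ᵇ 3 ⟧)
  ≡⟨ sumMaps-cong (λ f → trans (cong (λ k → ⟦ isHom G G f ⟧ * ⟦ k ≡ᵇ 3 ⟧) (length-homType f))
                               (sym (⟦⟧-∧ (isHom G G f) _))) ⟩
    selfHomsOfImageSize G 3
  ∎
  where
  open ≡-Reasoning
  n : ℕ
  n = nV G
  triple : Fin (suc n) → Fin (suc n) → Fin (suc n) → List ℕ
  triple a b c = toℕ a ∷ toℕ b ∷ toℕ c ∷ []
  term : Vec (Vertex G) n → Fin (suc n) → Fin (suc n) → Fin (suc n) → ℕ
  term f a b c = ⟦ isHom G G f ⟧ * ⟦ listEqᵇ (homType f) (triple a b c) ⟧
  pull : ∀ f → ∑[ a < suc n ] ∑[ b < suc n ] ∑[ c < suc n ] term f a b c ≡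
               ⟦ isHom G G f ⟧ * ∑[ a < suc n ] ∑[ b < suc n ] ∑[ c < suc n ] ⟦ listEqᵇ (homType f) (triple a b c) ⟧
  pull f = trans (sum-cong-≗ {suc n} (λ a → trans (sum-cong-≗ {suc n} (λ b → ∑-*ˡ h (λ c → eq a b c)))
                                                  (∑-*ˡ h (λ b → ∑[ c < suc n ] eq a b c))))
                 (∑-*ˡ h (λ a → ∑[ b < suc n ] ∑[ c < suc n ] eq a b c))
    where
    h : ℕ
    h = ⟦ isHom G G f ⟧
    eq : Fin (suc n) → Fin (suc n) → Fin (suc n) → ℕ
    eq a b c = ⟦ listEqᵇ (homType f) (triple a b c) ⟧

-- What the self-chromatic symmetric function determines

module _ {G H : Graph} (BG : ConnectedBipartite G) (BH : ConnectedBipartite H)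
         (3≤nV : 3 ≤ nV G) (X≡ : ∀ ν → Xself G ν ≡ Xself H ν) where

  private
    f₀ : Vec (Vertex G) (nV G)
    f₀ = Vec.tabulate (twoColouring BG)

    f₀≗ : ∀ x → lookup f₀ x ≡ twoColouring BG x
    f₀≗ = lookup∘tabulate (twoColouring BG)

    fibre-f₀ : ∀ w → fibre (lookup f₀) w ≡ fibre (twoColouring BG) w
    fibre-f₀ w = sum-cong-≗ (λ x → cong (λ y → ⟦ y == w ⟧) (f₀≗ x))

    f₀-hom : isHom G G f₀ ≡ true
    f₀-hom = isHom-complete G G f₀ (λ {u} {v} u~v →
      subst₂ (λ a b → adj G a b ≡ true) (sym (f₀≗ u)) (sym (f₀≗ v)) (twoColouring-hom BG u~v))

    ν₂ : List ℕ
    ν₂ = homType f₀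

    length-ν₂ : length ν₂ ≡ 2
    length-ν₂ = trans (length-homType f₀) (trans (sum-cong-≗ (λ w → cong (⟦_⟧ ∘ nonzero) (fibre-f₀ w))) (imageSize-twoColouring BG))

    d-ν₂>0 : 0 < d G G ν₂
    d-ν₂>0 = subst (0 <_) (sym (d≡sumMaps G G ν₂))
               (≤-trans (≤-reflexive (sym (cong₂ (λ a b → ⟦ a ⟧ * ⟦ b ⟧) f₀-hom (listEqᵇ-refl ν₂))))
                        (term≤sumMaps (λ f → ⟦ isHom G G f ⟧ * ⟦ listEqᵇ (homType f) ν₂ ⟧) f₀))

    homOfType-ν₂ : ∃[ g ] isHom H H g ≡ true × homType g ≡ ν₂
    homOfType-ν₂ =
      let g , g>0 = sumMaps>0 _ (subst (0 <_) (d≡sumMaps H H ν₂) (m*n>0⇒m>0 (subst (0 <_) (X≡ ν₂) X-ν₂>0)))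
      in  g , ⟦⟧>0⇒true (m*n>0⇒m>0 {⟦ isHom H H g ⟧} g>0) , listEqᵇ-sound _ _ (⟦⟧>0⇒true (m*n>0⇒n>0 {⟦ isHom H H g ⟧} g>0))
      where
      X-ν₂>0 : 0 < Xself G ν₂
      X-ν₂>0 = m*n>0 d-ν₂>0 (mNcoeff>0 (nV G) ν₂ (subst (_≤ nV G) (sym length-ν₂) (≤-trans (s≤s (s≤s z≤n)) 3≤nV)))

    g : Vec (Vertex H) (nV H)
    g = proj₁ homOfType-ν₂
    g-hom : isHom H H g ≡ true
    g-hom = proj₁ (proj₂ homOfType-ν₂)
    g-type : homType g ≡ ν₂
    g-type = proj₂ (proj₂ homOfType-ν₂)

  Xself⇒nV≡ : nV G ≡ nV H
  Xself⇒nV≡ = trans (sym (sum-homType f₀)) (trans (cong sum (sym g-type)) (sum-homType g))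

  -- The function s ↦ 2 ^ s ∸ 2 vanishes at 0 (truncated subtraction), so summing it over the parts of
  -- the type ν₂ of a 2-point image reads off the number of foldings.
  Xself⇒foldings≡ : foldings BG ≡ foldings BH
  Xself⇒foldings≡ = begin
      foldings BG
    ≡⟨ sym (∑-fibre-imageSize≡2 BG (twoColouring BG) (twoColouring-hom BG) (imageSize-twoColouring BG) h refl) ⟩
      ∑[ w < nV G ] h (fibre (twoColouring BG) w)
    ≡⟨ sym (sum-cong-≗ (cong h ∘ fibre-f₀)) ⟩
      ∑[ w < nV G ] h (fibre (lookup f₀) w)
    ≡⟨ sym (sum-map-homType h refl f₀) ⟩
      sum (map h ν₂)
    ≡⟨ cong (sum ∘ map h) (sym g-type) ⟩
      sum (map h (homType g))
    ≡⟨ sum-map-homType h refl g ⟩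
      ∑[ w < nV H ] h (fibre (lookup g) w)
    ≡⟨ ∑-fibre-imageSize≡2 BH (lookup g) (isHom-sound H H g g-hom) g-image h refl ⟩
      foldings BH
    ∎
    where
    open ≡-Reasoning
    h : ℕ → ℕ
    h s = 2 ^ s ∸ 2
    g-image : imageSize (lookup g) ≡ 2
    g-image = trans (sym (length-homType g)) (trans (cong length g-type) length-ν₂)

  Xself⇒d≡ : ∀ ν → length ν ≡ 3 → d G G ν ≡ d H H ν
  Xself⇒d≡ ν ℓ≡3 = *-cancelʳ-≡ (d G G ν) (d H H ν) (mNcoeff (nV G) ν) {{>-nonZero mN>0}}
                     (trans (X≡ ν) (cong (λ N → d H H ν * mNcoeff N ν) (sym Xself⇒nV≡)))
    where
    mN>0 : 0 < mNcoeff (nV G) ν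
    mN>0 = mNcoeff>0 (nV G) ν (subst (_≤ nV G) (sym ℓ≡3) 3≤nV)

  Xself⇒selfHoms₃≡ : selfHomsOfImageSize G 3 ≡ selfHomsOfImageSize H 3
  Xself⇒selfHoms₃≡ = begin
      selfHomsOfImageSize G 3
    ≡⟨ sym (selfHoms₃≡∑d G) ⟩
      ∑[ a < suc (nV G) ] ∑[ b < suc (nV G) ] ∑[ c < suc (nV G) ] d G G (toℕ a ∷ toℕ b ∷ toℕ c ∷ [])
    ≡⟨ sum-cong-≗ {suc (nV G)} (λ a → sum-cong-≗ {suc (nV G)} (λ b → sum-cong-≗ {suc (nV G)} (λ c →
         Xself⇒d≡ (toℕ a ∷ toℕ b ∷ toℕ c ∷ []) refl))) ⟩
      ∑[ a < suc (nV G) ] ∑[ b < suc (nV G) ] ∑[ c < suc (nV G) ] d H H (toℕ a ∷ toℕ b ∷ toℕ c ∷ [])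
    ≡⟨ cong (λ N → ∑[ a < suc N ] ∑[ b < suc N ] ∑[ c < suc N ] d H H (toℕ a ∷ toℕ b ∷ toℕ c ∷ [])) Xself⇒nV≡ ⟩
      ∑[ a < suc (nV H) ] ∑[ b < suc (nV H) ] ∑[ c < suc (nV H) ] d H H (toℕ a ∷ toℕ b ∷ toℕ c ∷ [])
    ≡⟨ selfHoms₃≡∑d H ⟩
      selfHomsOfImageSize H 3
    ∎
    where open ≡-Reasoning

  Xself⇒cherries≡ : cherries G ≡ cherries H
  Xself⇒cherries≡ = *-cancelʳ-≡ (cherries G) (cherries H) (foldings BG) {{>-nonZero (foldings>0 BG 3≤nV)}} (begin
      cherries G * foldings BG     ≡⟨ sym (2*selfHoms₃≡cherries*foldings BG) ⟩
      2 * selfHomsOfImageSize G 3  ≡⟨ cong (2 *_) Xself⇒selfHoms₃≡ ⟩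
      2 * selfHomsOfImageSize H 3  ≡⟨ 2*selfHoms₃≡cherries*foldings BH ⟩
      cherries H * foldings BH     ≡⟨ cong (cherries H *_) (sym Xself⇒foldings≡) ⟩
      cherries H * foldings BG     ∎)
    where open ≡-Reasoning

-- Spiders

-- isStart legs is startsFrom legs 0; the offset o makes the recursion over the legs go through.
startsFrom : List ℕ → ℕ → ℕ → Bool
startsFrom legs o v = any (λ s → s ≡ᵇ v) (legStarts legs o)

startsFrom-above : ∀ legs o v → v ≤ o → startsFrom legs o v ≡ false
startsFrom-above []       o v v≤o = refl
startsFrom-above (a ∷ as) o v v≤o with suc o ≡ᵇ v in e
... | true  = ⊥-elim (1+n≰n (subst (_≤ o) (sym (≡ᵇ⇒≡ (suc o) v (subst T (sym e) tt))) v≤o))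
... | false = startsFrom-above as (o + a) v (≤-trans v≤o (m≤m+n o a))

∑-startsFrom : ∀ legs o → All (1 ≤_) legs → ∑[ v < suc (o + sum legs) ] ⟦ startsFrom legs o (toℕ v) ⟧ ≡ length legs
∑-startsFrom []       o _ = ∑-zero {suc (o + 0)} _ (λ _ → refl)
∑-startsFrom (a ∷ as) o (1≤a ∷ pos) = begin
    ∑[ v < N ] ⟦ (suc o ≡ᵇ toℕ v) ∨ startsFrom as (o + a) (toℕ v) ⟧
  ≡⟨ sum-cong-≗ {N} (λ v → ⟦⟧-∨ _ _ (later-starts (toℕ v))) ⟩
    ∑[ v < N ] (⟦ suc o ≡ᵇ toℕ v ⟧ + ⟦ startsFrom as (o + a) (toℕ v) ⟧)
  ≡⟨ ∑-distrib-+ {N} (λ v → ⟦ suc o ≡ᵇ toℕ v ⟧) (λ v → ⟦ startsFrom as (o + a) (toℕ v) ⟧) ⟩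
    ∑[ v < N ] ⟦ suc o ≡ᵇ toℕ v ⟧ + ∑[ v < N ] ⟦ startsFrom as (o + a) (toℕ v) ⟧
  ≡⟨ cong₂ _+_ (∑-≡ᵇ-toℕ N (suc o) (s≤s (≤-trans o<o+a (+-monoʳ-≤ o (m≤m+n a (sum as))))))
               (trans (cong (λ M → ∑[ v < suc M ] ⟦ startsFrom as (o + a) (toℕ v) ⟧) (sym (+-assoc o a (sum as))))
                      (∑-startsFrom as (o + a) pos)) ⟩
    suc (length as)
  ∎
  where
  open ≡-Reasoning
  N : ℕ
  N = suc (o + (a + sum as))
  o<o+a : suc o ≤ o + a
  o<o+a = subst (_≤ o + a) (+-comm o 1) (+-monoʳ-≤ o 1≤a)
  later-starts : ∀ v → (suc o ≡ᵇ v) ≡ true → startsFrom as (o + a) v ≡ false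
  later-starts v e = startsFrom-above as (o + a) v (subst (_≤ o + a) (≡ᵇ⇒≡ (suc o) v (subst T (sym e) tt)) o<o+a)

isStart-0 : ∀ legs → isStart legs 0 ≡ false
isStart-0 legs = startsFrom-above legs 0 0 z≤n

parentLabel : List ℕ → ℕ → ℕ
parentLabel legs zero    = zero
parentLabel legs (suc a) = if isStart legs (suc a) then 0 else a

parentLabel-< : ∀ legs a → parentLabel legs (suc a) < suc a
parentLabel-< legs a with isStart legs (suc a)
... | true  = s≤s z≤n
... | false = ≤-refl

parentLabel-≤ : ∀ legs v → parentLabel legs v ≤ v
parentLabel-≤ legs zero    = z≤n
parentLabel-≤ legs (suc a) = <⇒≤ (parentLabel-< legs a)

step-< : ∀ legs x y → step legs x y ≡ true → x < y
step-< legs zero    zero    e = ⊥-elim (true≢false (trans (sym e) (isStart-0 legs)))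
step-< legs zero    (suc y) _ = s≤s z≤n
step-< legs (suc u) y       e = ≤-reflexive (sym (≡ᵇ⇒≡ y (suc (suc u)) (subst T (sym (∧-conicalˡ _ _ e)) tt)))

step-parent : ∀ legs x y → step legs x y ≡ true → parentLabel legs y ≡ x
step-parent legs x       zero    e = ⊥-elim (1+n≰n (≤-trans (step-< legs x 0 e) z≤n))
step-parent legs zero    (suc b) e rewrite e = refl
step-parent legs (suc u) (suc b) e with ≡ᵇ⇒≡ b (suc u) (subst T (sym (∧-conicalˡ _ _ e)) tt)
... | refl rewrite not≡true (∧-conicalʳ (suc b ≡ᵇ suc (suc u)) (not (isStart legs (suc b))) e) = refl

parent-step : ∀ legs b → suc b < suc (sum legs) → step legs (parentLabel legs (suc b)) (suc b) ≡ true
parent-step []       b (s≤s ())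
parent-step (a ∷ as) b _ with isStart (a ∷ as) (suc b) in e
... | true = e
parent-step (a ∷ as) zero    _ | false = ⊥-elim (true≢false e)
parent-step (a ∷ as) (suc b) _ | false rewrite e = trans (∧-identityʳ (b ≡ᵇ b)) (≡ᵇ-refl b)

-- Parity of the distance to the torso; the label bounds the recursion depth because parent labels decrease.
depthParityWithin : List ℕ → ℕ → ℕ → Bool
depthParityWithin legs zero    v       = false
depthParityWithin legs (suc k) zero    = false
depthParityWithin legs (suc k) (suc a) = not (depthParityWithin legs k (parentLabel legs (suc a)))

depthParityWithin-fuel : ∀ legs {k k′} v → v ≤ k → v ≤ k′ → depthParityWithin legs k v ≡ depthParityWithin legs k′ v
depthParityWithin-fuel legs {zero}  {zero}   v       _         _          = refl
depthParityWithin-fuel legs {zero}  {suc k′} zero    _         _          = refl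
depthParityWithin-fuel legs {suc k} {zero}   zero    _         _          = refl
depthParityWithin-fuel legs {suc k} {suc k′} zero    _         _          = refl
depthParityWithin-fuel legs {suc k} {suc k′} (suc a) (s≤s a≤k) (s≤s a≤k′) =
  cong not (depthParityWithin-fuel legs (parentLabel legs (suc a)) (≤-trans p≤a a≤k) (≤-trans p≤a a≤k′))
  where
  p≤a : parentLabel legs (suc a) ≤ a
  p≤a = ≤-pred (parentLabel-< legs a)

depthParity : List ℕ → ℕ → Bool
depthParity legs v = depthParityWithin legs v v

depthParity-step : ∀ legs {x y} → step legs x y ≡ true → depthParity legs x ≡ not (depthParity legs y)
depthParity-step legs {x} {zero}  e = ⊥-elim (1+n≰n (≤-trans (step-< legs x 0 e) z≤n))
depthParity-step legs {x} {suc b} e = begin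
    depthParity legs x                                          ≡⟨ cong (depthParity legs) (sym (step-parent legs x (suc b) e)) ⟩
    depthParity legs p                                          ≡⟨ sym (not-involutive _) ⟩
    not (not (depthParity legs p))                              ≡⟨ cong not (cong not (depthParityWithin-fuel legs p ≤-refl p≤b)) ⟩
    not (depthParity legs (suc b))                              ∎
  where
  open ≡-Reasoning
  p : ℕ
  p = parentLabel legs (suc b)
  p≤b : p ≤ b
  p≤b = ≤-pred (parentLabel-< legs b)

isStart-1 : ∀ legs → 1 ≤ sum legs → isStart legs 1 ≡ true
isStart-1 (a ∷ as) _ = refl

spider-connectedBipartite : ∀ legs → 1 ≤ sum legs → ConnectedBipartite (spider legs)
spider-connectedBipartite legs 1≤S = record
  { adj-sym       = λ u v → ∨-comm (step legs (toℕ u) (toℕ v)) (step legs (toℕ v) (toℕ u))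
  ; colour        = depthParity legs ∘ toℕ
  ; colour-adj    = λ {u} {v} → colour-adj {u} {v}
  ; root          = zero
  ; child         = child
  ; root~child    = subst (λ m → step legs 0 m ∨ step legs m 0 ≡ true) (sym (toℕ-fromℕ< (s≤s 1≤S)))
                          (cong (_∨ step legs 1 0) (isStart-1 legs 1≤S))
  ; parent        = parent
  ; height        = toℕ
  ; parent~       = parent~
  ; height-parent = height-parent
  }
  where
  n : ℕ
  n = suc (sum legs)
  child : Fin n
  child = fromℕ< (s≤s 1≤S)
  colour-adj : ∀ {u v : Fin n} → adj (spider legs) u v ≡ true → depthParity legs (toℕ u) ≡ not (depthParity legs (toℕ v))
  colour-adj {u} {v} u~v with step legs (toℕ u) (toℕ v) in e
  ... | true  = depthParity-step legs {toℕ u} {toℕ v} e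
  ... | false = trans (sym (not-involutive _)) (cong not (sym (depthParity-step legs {toℕ v} {toℕ u} u~v)))
  parent : Fin n → Fin n
  parent v = fromℕ< (≤-<-trans (parentLabel-≤ legs (toℕ v)) (toℕ<n v))
  toℕ-parent : ∀ v → toℕ (parent v) ≡ parentLabel legs (toℕ v)
  toℕ-parent v = toℕ-fromℕ< (≤-<-trans (parentLabel-≤ legs (toℕ v)) (toℕ<n v))
  parent~ : ∀ v → v ≢ zero → adj (spider legs) (parent v) v ≡ true
  parent~ zero    v≢0 = ⊥-elim (v≢0 refl)
  parent~ (suc i) _   rewrite toℕ-parent (suc i) | parent-step legs (toℕ i) (toℕ<n (suc i)) = refl
  height-parent : ∀ v → v ≢ zero → toℕ (parent v) < toℕ v
  height-parent zero    v≢0 = ⊥-elim (v≢0 refl)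
  height-parent (suc i) _   rewrite toℕ-parent (suc i) = parentLabel-< legs (toℕ i)

module _ (legs : List ℕ) where

  private
    n k : ℕ
    n = suc (sum legs)
    k = length legs

    children parents cherriesAt : Fin n → ℕ
    children v   = ∑[ u < n ] ⟦ step legs (toℕ v) (toℕ u) ⟧
    parents v    = ∑[ u < n ] ⟦ step legs (toℕ u) (toℕ v) ⟧
    cherriesAt v = ∑[ u < n ] ∑[ w < n ] ⟦ cherry (spider legs) v u w ⟧

    degree≡ : ∀ v → count (adj (spider legs) v) ≡ children v + parents v
    degree≡ v = trans (sum-cong-≗ {n} (λ u → ⟦⟧-∨ _ _ (one-way u)))
                      (∑-distrib-+ {n} (λ u → ⟦ step legs (toℕ v) (toℕ u) ⟧) (λ u → ⟦ step legs (toℕ u) (toℕ v) ⟧))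
      where
      one-way : ∀ u → step legs (toℕ v) (toℕ u) ≡ true → step legs (toℕ u) (toℕ v) ≡ false
      one-way u e with step legs (toℕ u) (toℕ v) in e′
      ... | false = refl
      ... | true  = ⊥-elim (<-asym (step-< legs (toℕ v) (toℕ u) e) (step-< legs (toℕ u) (toℕ v) e′))

    parents-root : parents zero ≡ 0
    parents-root = ∑-zero {n} _ (λ u → cong ⟦_⟧ (no-step (toℕ u)))
      where
      no-step : ∀ x → step legs x 0 ≡ false
      no-step x with step legs x 0 in e
      ... | false = refl
      ... | true  = ⊥-elim (1+n≰n (≤-trans (step-< legs x 0 e) z≤n))

    parents-suc : ∀ i → parents (suc i) ≡ 1
    parents-suc i = trans (sum-cong-≗ {n} (λ u → cong ⟦_⟧ (step≡parent (toℕ u))))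
                          (∑-≡ᵇ-toℕ n p (≤-<-trans (parentLabel-≤ legs y) (toℕ<n (suc i))))
      where
      y p : ℕ
      y = suc (toℕ i)
      p = parentLabel legs y
      step≡parent : ∀ x → step legs x y ≡ (p ≡ᵇ x)
      step≡parent x = Bool-ext
        (λ e → subst (λ z → (p ≡ᵇ z) ≡ true) (step-parent legs x y e) (≡ᵇ-refl p))
        (λ e → subst (λ z → step legs z y ≡ true) (≡ᵇ⇒≡ p x (subst T (sym e) tt)) (parent-step legs (toℕ i) (toℕ<n (suc i))))

    ∑-children : ∑ children ≡ sum legs
    ∑-children = begin
        ∑[ v < n ] ∑[ u < n ] ⟦ step legs (toℕ v) (toℕ u) ⟧  ≡⟨ ∑-comm {n} {n} (λ v u → ⟦ step legs (toℕ v) (toℕ u) ⟧) ⟩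
        ∑ parents                                            ≡⟨ cong₂ _+_ parents-root (sum-cong-≗ parents-suc) ⟩
        ∑[ i < sum legs ] 1                                  ≡⟨ ∑-one (sum legs) ⟩
        sum legs                                             ∎
      where open ≡-Reasoning

    children-root : All (1 ≤_) legs → children zero ≡ k
    children-root pos = ∑-startsFrom legs 0 pos

    children-suc≤1 : ∀ i → children (suc i) ≤ 1
    children-suc≤1 i = ≤-trans (∑-mono {n} (λ u → at-most (toℕ u))) (∑-≡ᵇ-toℕ≤1 n (suc (suc (toℕ i))))
      where
      at-most : ∀ x → ⟦ step legs (suc (toℕ i)) x ⟧ ≤ ⟦ suc (suc (toℕ i)) ≡ᵇ x ⟧
      at-most x rewrite ≡ᵇ-sym x (suc (suc (toℕ i))) with suc (suc (toℕ i)) ≡ᵇ x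
      ... | true  = ⟦⟧≤1 _
      ... | false = z≤n

    cherriesAt-suc : ∀ i → cherriesAt (suc i) ≡ 2 * children (suc i)
    cherriesAt-suc i = solve (children (suc i)) (children-suc≤1 i)
      (subst (λ d → cherriesAt (suc i) + d ≡ d * d) (trans (degree≡ (suc i)) (cong (children (suc i) +_) (parents-suc i)))
             (∑-distinct-pairs (adj (spider legs) (suc i))))
      where
      solve : ∀ c → c ≤ 1 → cherriesAt (suc i) + (c + 1) ≡ (c + 1) * (c + 1) → cherriesAt (suc i) ≡ 2 * c
      solve zero          _         e = +-cancelʳ-≡ 1 _ 0 e
      solve (suc zero)    _         e = +-cancelʳ-≡ 2 _ 2 e
      solve (suc (suc c)) (s≤s ()) _

  cherries-spider : All (1 ≤_) legs → cherries (spider legs) + 3 * length legs ≡ length legs * length legs + 2 * sum legs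
  cherries-spider pos = begin
      cherries (spider legs) + 3 * k
    ≡⟨⟩
      cherriesAt zero + ∑[ i < sum legs ] cherriesAt (suc i) + 3 * k
    ≡⟨ cong (λ x → cherriesAt zero + x + 3 * k) (trans (sum-cong-≗ cherriesAt-suc) (∑-*ˡ 2 (children ∘ suc))) ⟩
      cherriesAt zero + 2 * inner + 3 * k
    ≡⟨ rearrange (cherriesAt zero) inner k ⟩
      (cherriesAt zero + k) + 2 * (k + inner)
    ≡⟨ cong₂ (λ x y → x + 2 * y) torso (trans (cong (_+ inner) (sym (children-root pos))) ∑-children) ⟩
      k * k + 2 * sum legs
    ∎
    where
    open ≡-Reasoning
    inner : ℕ
    inner = ∑[ i < sum legs ] children (suc i)
    torso : cherriesAt zero + k ≡ k * k
    torso = subst (λ d → cherriesAt zero + d ≡ d * d)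
                  (trans (degree≡ zero) (trans (cong (children zero +_) parents-root) (trans (+-identityʳ _) (children-root pos))))
                  (∑-distinct-pairs (adj (spider legs) zero))
    rearrange : ∀ a c k → a + 2 * c + 3 * k ≡ (a + k) + 2 * (k + c)
    rearrange = solve-∀

length≤sum : ∀ {xs} → All (1 ≤_) xs → length xs ≤ sum xs
length≤sum []         = z≤n
length≤sum (1≤x ∷ ps) = +-mono-≤ 1≤x (length≤sum ps)

-- k′ * k′ + 3 * k exceeds k * k + 3 * k′ by (k′ − k) (k′ + k − 3), written here with k = 2 + j, k′ = 3 + j + d.
quadratic-gap : ∀ j d → (3 + j + d) * (3 + j + d) + 3 * (2 + j) ≡ ((2 + j) * (2 + j) + 3 * (3 + j + d)) + suc d * (2 + 2 * j + d)
quadratic-gap = solve-∀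

balance : ∀ P Q X Y A B → P + A ≡ X + Q → P + B ≡ Y + Q → X + B ≡ Y + A
balance P Q X Y A B e e′ = +-cancelʳ-≡ Q (X + B) (Y + A) (begin
    X + B + Q  ≡⟨ swap-last X B Q ⟩
    X + Q + B  ≡⟨ cong (_+ B) (sym e) ⟩
    P + A + B  ≡⟨ swap-last P A B ⟩
    P + B + A  ≡⟨ cong (_+ A) e′ ⟩
    Y + Q + A  ≡⟨ swap-last Y Q A ⟩
    Y + A + Q  ∎)
  where
  open ≡-Reasoning
  swap-last : ∀ a b c → a + b + c ≡ a + c + b
  swap-last = solve-∀

k²-3k-no-larger : ∀ {P Q k k′} → 2 ≤ k → k < k′ → P + 3 * k ≡ k * k + Q → P + 3 * k′ ≡ k′ * k′ + Q → ⊥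
k²-3k-no-larger {P} {Q} {suc (suc j)} {k′} (s≤s (s≤s _)) k<k′ e e′ = m+1+n≢m (sq + lin′) (sym (trans balanced (quadratic-gap j r)))
  where
  r : ℕ
  r = k′ ∸ (3 + j)
  sq lin sq′ lin′ : ℕ
  sq   = (2 + j) * (2 + j)
  lin  = 3 * (2 + j)
  sq′  = (3 + j + r) * (3 + j + r)
  lin′ = 3 * (3 + j + r)
  balanced : sq + lin′ ≡ sq′ + lin
  balanced = balance P Q sq sq′ lin lin′ e (subst (λ x → P + 3 * x ≡ x * x + Q) (sym (m+[n∸m]≡n k<k′)) e′)

k²-3k-injective : ∀ {P Q k k′} → 2 ≤ k → 2 ≤ k′ → P + 3 * k ≡ k * k + Q → P + 3 * k′ ≡ k′ * k′ + Q → k ≡ k′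
k²-3k-injective {P} {Q} {k} {k′} 2≤k 2≤k′ e e′ with <-cmp k k′
... | tri≈ _ k≡k′ _ = k≡k′
... | tri< k<k′ _ _ = ⊥-elim (k²-3k-no-larger {P} {Q} 2≤k k<k′ e e′)
... | tri> _ _ k′<k = ⊥-elim (k²-3k-no-larger {P} {Q} 2≤k′ k′<k e′ e)

proposition2p13 : (λ₁ μ : List ℕ) → IsPartition λ₁ → IsPartition μ → 3 ≤ ℓ λ₁ → 3 ≤ ℓ μ → (∀ ν → Xself (spider λ₁) ν ≡ Xself (spider μ) ν) → ℓ λ₁ ≡ ℓ μ
proposition2p13 λ₁ μ (posλ , _) (posμ , _) 3≤ℓλ 3≤ℓμ X≡ =
  k²-3k-injective {cherries (spider λ₁)} {2 * sum λ₁} (≤-trans 2≤3 3≤ℓλ) (≤-trans 2≤3 3≤ℓμ)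
    (cherries-spider λ₁ posλ)
    (subst₂ (λ P S → P + 3 * ℓ μ ≡ ℓ μ * ℓ μ + 2 * S) (sym cherries≡) (sym sum≡) (cherries-spider μ posμ))
  where
  2≤3 : 2 ≤ 3
  2≤3 = s≤s (s≤s z≤n)
  3≤Sλ : 3 ≤ sum λ₁
  3≤Sλ = ≤-trans 3≤ℓλ (length≤sum posλ)
  3≤Sμ : 3 ≤ sum μ
  3≤Sμ = ≤-trans 3≤ℓμ (length≤sum posμ)
  Tλ : ConnectedBipartite (spider λ₁)
  Tλ = spider-connectedBipartite λ₁ (≤-trans (s≤s z≤n) 3≤Sλ)
  Tμ : ConnectedBipartite (spider μ)
  Tμ = spider-connectedBipartite μ (≤-trans (s≤s z≤n) 3≤Sμ)
  3≤nV : 3 ≤ nV (spider λ₁)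
  3≤nV = m≤n⇒m≤1+n 3≤Sλ
  sum≡ : sum λ₁ ≡ sum μ
  sum≡ = suc-injective (Xself⇒nV≡ Tλ Tμ 3≤nV X≡)
  cherries≡ : cherries (spider λ₁) ≡ cherries (spider μ)
  cherries≡ = Xself⇒cherries≡ Tλ Tμ 3≤nV X≡
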